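{- Let $k\geq3$ and $n\geq 3$, and write $n=2^tm$ with $t\geq 0$ and $m$ odd. Let $\delta=1$ if $k$ is odd and $\delta=2$ if $k$ is even. Let $X_k(n-1)$ be any set of edges of $B_k(n-1)$ obtained as the union of $E_k(n-1)$ with the edge sets of exactly one circuit from each reverse-complementary pair of non-negasymmetric circuits in $\mathcal{C}_k(n-1)$. Then \[ |X_k(n-1)|\geq \max\left(\frac{k^n-r_{k,n,kn/2}}{2},~s_k(n-1)\right), \] where \[ s_k(n-1) = \frac{k^n - n(|N_0(n,k)|+|N_2(n,k)|)-m(|N_1(n,k)|-\delta)-\delta}{2}, \] or equivalently \[ s_k(n-1)=\frac{k^n-\delta\left(n(k^{(n-1)/2}-1)+1\right)}{2}\ \text{ if $n$ is odd},\] \[ s_k(n-1)=\frac{k^n - \frac{nk^{(n-2)/2}}{2}(\delta^2+k) +n\delta k^{(m-1)/2} - m\delta(k^{(m-1)/2}-1)-\delta}{2}\ \text{ if $n$ is even}. \]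
   Context: Tuples are $k$-ary (entries in $\mathbb{Z}_k$), negation is modulo $k$, $\mathbf{u}^R$ is the reverse of $\mathbf{u}$; an $n$-tuple $\mathbf{u}$ is negasymmetric if $\mathbf{u}=-\mathbf{u}^R$. The pseudoweight of $a\in\mathbb{Z}_k$ is $a$ if $a\neq0$ and $k/2$ if $a=0$; the pseudoweight of a tuple is the sum over its entries. $r_{k,n,s}$ is the number of $k$-ary $n$-tuples of pseudoweight $s$. $B_k(n-1)$ is the de Bruijn digraph with vertices the $k$-ary $(n-1)$-tuples and edges the $k$-ary $n$-tuples $(a_0,\dots,a_{n-1})$, going from $(a_0,\dots,a_{n-2})$ to $(a_1,\dots,a_{n-1})$. $E_k(n-1)$ is the set of edges of pseudoweight less than $kn/2$; $H_k(n-1)$ is the subgraph with edges of pseudoweight exactly $kn/2$. For an $n$-tuple $(a_0,\dots,a_{n-1})$ with $m'$ the least positive $c$ such that $a_i=a_{(i+c)\bmod n}$ for all $i$, $[a_0,\dots,a_{n-1}]$ is the circuit with edges the $m'$ cyclic shifts $(a_j,\dots,a_{j+n-1})$ (indices mod $n$), $0\le j<m'$. $\mathcal{C}_k(n-1)$ is the set of such circuits arising from edges of $H_k(n-1)$. A circuit is negasymmetric if it contains edges $\mathbf{a},\mathbf{b}$ (not necessarily distinct) with $\mathbf{a}=-\mathbf{b}^R$, otherwise non-negasymmetric. A non-negasymmetric $[a_0,\dots,a_{n-1}]\in\mathcal{C}_k(n-1)$ and the (distinct, non-negasymmetric) circuit $[-a_{n-1},\dots,-a_0]$ form a reverse-complementary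 pair. For $i\ge0$, $N_i(n,k)$ is the set of negasymmetric circuits in $\mathcal{C}_k(n-1)$ that contain exactly $i$ negasymmetric $n$-tuples (as edges). -}

module Defs where

open import Data.Nat as ℕ using (ℕ; zero; suc; _*_; _∸_; _<_; NonZero)
open import Data.Nat.DivMod using (_mod_)
open import Data.Nat.Divisibility using (_∣?_)
open import Data.Fin as Fin using (Fin; toℕ)
open import Data.Fin.Properties using () renaming (_≟_ to _≟F_)
open import Data.Vec as Vec using (Vec; []; _∷_; _∷ʳ_; reverse)
open import Data.Vec.Properties using (≡-dec)
open import Data.List as List using (List; length; filter; upTo; concatMap)
open import Data.Bool.ListAction using (any)
open import Relation.Nullary.Decidable using (T?)
open import Data.Bool using (Bool; true; false; _∧_; if_then_else_; T)
open import Data.Product using (Σ; ∃; ∃-syntax; _×_)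
open import Data.Sum using (_⊎_)
open import Relation.Nullary using (¬_; does)
open import Relation.Binary.PropositionalEquality using (_≡_)
open import Function using (_∘_)

Tuple : ℕ → ℕ → Set
Tuple k n = Vec (Fin k) n

allTuples : (k n : ℕ) → List (Tuple k n)
allTuples k zero = [] List.∷ List.[]
allTuples k (suc n) =
  concatMap (λ a → List.map (a ∷_) (allTuples k n)) (List.allFin k)

count : {k n : ℕ} → (Tuple k n → Bool) → ℕ
count {k} {n} P = length (filter (λ u → T? (P u)) (allTuples k n))

negF : {k : ℕ} → Fin k → Fin k
negF {suc k} a = (suc k ∸ toℕ a) mod (suc k)

-- twice the pseudoweight of an entry: 2a if a ≠ 0, and k if a = 0
pw2 : {k : ℕ} → Fin k → ℕ
pw2 {k} a = if does (toℕ a ℕ.≟ 0) then k else 2 * toℕ a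

pw2T : {k n : ℕ} → Tuple k n → ℕ
pw2T [] = 0
pw2T (a ∷ u) = pw2 a ℕ.+ pw2T u

negRev : {k n : ℕ} → Tuple k n → Tuple k n
negRev u = Vec.map negF (reverse u)

_≟T_ : {k n : ℕ} → (u v : Tuple k n) → _
_≟T_ = ≡-dec _≟F_

rot : {k n : ℕ} → Tuple k n → Tuple k n
rot [] = []
rot (a ∷ u) = u ∷ʳ a

rotN : {k n : ℕ} → ℕ → Tuple k n → Tuple k n
rotN zero u = u
rotN (suc j) u = rotN j (rot u)

-- v is an edge of the circuit [u], i.e. v is a cyclic shift of u
-- (the shifts by 0 ≤ j < n give the same edge set as 0 ≤ j < m')
inCircuit : {k n : ℕ} → Tuple k n → Tuple k n → Bool
inCircuit {n = n} u v = any (λ j → does (rotN j u ≟T v)) (upTo n)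

isNegasym : {k n : ℕ} → Tuple k n → Bool
isNegasym u = does (u ≟T negRev u)

-- the circuit [u] lies in 𝒞_k(n-1): u is an edge of H_k(n-1),
-- i.e. has pseudoweight exactly kn/2
InC : {k n : ℕ} → Tuple k n → Set
InC {k} {n} u = pw2T u ≡ k * n

NegasymCircuit : {k n : ℕ} → Tuple k n → Set
NegasymCircuit u = ∃[ a ] ∃[ b ] (T (inCircuit u a) × T (inCircuit u b) × a ≡ negRev b)

negasymEdgeCount : {k n : ℕ} → Tuple k n → ℕ
negasymEdgeCount u = count (λ v → inCircuit u v ∧ isNegasym v)

InN : (i : ℕ) {k n : ℕ} → Tuple k n → Set
InN i u = InC u × NegasymCircuit u × negasymEdgeCount u ≡ i

-- N is the number of circuits [u] with P u (P invariant under shifts):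
-- a list of N representatives, pairwise giving distinct circuits,
-- representing every such circuit
CircuitCount : {k n : ℕ} → (Tuple k n → Set) → ℕ → Set
CircuitCount {k} {n} P N =
  Σ (Fin N → Tuple k n) λ L →
    (∀ i → P (L i)) ×
    (∀ i j → T (inCircuit (L i) (L j)) → i ≡ j) ×
    (∀ u → P u → ∃[ i ] T (inCircuit (L i) u))

rMid : (k n : ℕ) → ℕ
rMid k n = count {k} {n} (λ v → does (pw2T v ℕ.≟ k * n))

δ : ℕ → ℕ
δ k = if does (2 ∣? k) then 2 else 1

-- X (given by its indicator) is an admissible edge set X_k(n-1):
-- sel u says that the circuit [u] is among the chosen circuits
IsX : {k n : ℕ} → (Tuple k n → Bool) → Set
IsX {k} {n} X = Σ (Tuple k n → Bool) λ sel →
    -- sel is a well-defined predicate on circuits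
    (∀ u v → T (inCircuit u v) → sel u ≡ sel v) ×
    (∀ u → T (sel u) → InC u × ¬ NegasymCircuit u) ×
    (∀ u → InC u → ¬ NegasymCircuit u →
        (T (sel u) × ¬ T (sel (negRev u))) ⊎ (¬ T (sel u) × T (sel (negRev u)))) ×
    -- X = E_k(n-1) ∪ (edges of the chosen circuits)
    (∀ v → (T (X v) → (pw2T v < k * n) ⊎ (∃[ u ] (T (sel u) × T (inCircuit u v)))) ×
           ((pw2T v < k * n) ⊎ (∃[ u ] (T (sel u) × T (inCircuit u v))) → T (X v)))

module Submission where

-- Reversal with negation, u ↦ -u^R, exchanges the edges of pseudoweight below and above kn/2, so
-- k^n = 2|E| + r, where r counts the balanced edges (pseudoweight exactly kn/2).  A balanced edge u on a
-- non-negasymmetric circuit is paired with -u^R, and exactly one of the two lies in X; hence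
-- k^n ≤ 2|X| + S, where S counts the edges of the negasymmetric circuits, and S ≤ r is the first bound.
-- If -u^R = rot^c u and the circuit [u] has period p, then v = rot^j u is negasymmetric iff 2j ≡ c, and
-- rot v = -v^R iff 2j + 1 ≡ c (mod p); every residue is hit twice by 0, 1, …, 2p - 1, so each negasymmetric
-- circuit lies in N₀ ∪ N₁ ∪ N₂.  Circuits in N₁ have odd period, which therefore divides m, and the
-- constant circuits [0…0] (and [k/2…k/2] for even k) lie in N₁ with a single edge; this bounds S by
-- n(|N₀| + |N₂|) + m|N₁| - δ(m - 1), which gives the second bound.  Counting negasymmetric tuples, and
-- those fixed by rot^m (one on each circuit of N₁), evaluates |N₀| + |N₁| + |N₂| and |N₁|, giving the
-- closed forms.

module Lemmas where

  open import Defs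
  open import Data.Nat as ℕ using (ℕ; zero; suc; _+_; _*_; _∸_; _^_; _≤_; _<_; z≤n; s≤s; s≤s⁻¹; _%_; NonZero)
  open import Data.Nat.Properties
  open import Algebra.Properties.CommutativeMonoid.Sum +-0-commutativeMonoid using (sum; sum-syntax; ∑-distrib-+; sum-cong-≗)
  open import Data.Nat.DivMod using (_/_; n%n≡0; m<n⇒m%n≡m; m%n<n; [m+n]%n≡m%n; m≡m%n+[m/n]*n)
  open import Data.Nat.Divisibility using (_∣_; divides; _∣?_; ∣-trans; ∣⇒≤; 0∣⇒≡0; m%n≡0⇒n∣m; n∣m*n)
  open import Data.Nat.Coprimality using (Coprime; coprime-divisor)
  open import Data.Fin as Fin using (Fin; toℕ; fromℕ<)
  import Data.Fin.Properties as Finₚ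
  open import Data.Vec as Vec using (Vec; []; _∷_; _∷ʳ_; _++_; toList; replicate; head; tail; splitAt)
  import Data.Vec.Properties as Vecₚ
  open import Data.List as List using (List; []; _∷_; filter; length; map; allFin; upTo; concatMap)
  import Data.List.Properties as Listₚ
  open import Data.List.Membership.Propositional using (_∈_; find; lose)
  open import Data.List.Membership.Propositional.Properties
  open import Data.List.Relation.Binary.Subset.Propositional using (_⊆_)
  open import Data.List.Relation.Unary.All as All using (All; []; _∷_)
  open import Data.List.Relation.Unary.AllPairs as AllPairs using ([]; _∷_)
  open import Data.List.Relation.Unary.Any using (here; there)
  open import Data.List.Relation.Unary.Unique.Propositional using (Unique)
  import Data.List.Relation.Unary.Unique.Propositional.Properties as Uniqueₚ
  import Data.List.Relation.Unary.All.Properties as Allₚ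
  import Data.List.Relation.Unary.Any.Properties as Anyₚ
  import Data.List.Relation.Unary.AllPairs.Properties as AllPairsₚ
  open import Data.List.Relation.Binary.Disjoint.Propositional using (Disjoint)
  open import Data.Bool using (Bool; true; false; T; not; _∧_; if_then_else_)
  open import Data.Bool.Properties using (T-∧)
  open import Data.Unit using (tt)
  open import Data.Empty using (⊥-elim)
  open import Data.Product using (∃-syntax; _×_; _,_; proj₁; proj₂)
  open import Data.Sum using (_⊎_; inj₁; inj₂)
  open import Function using (_∘_; case_of_; Equivalence; _⇔_; mk⇔)
  open import Relation.Nullary using (¬_; ¬?; Dec; yes; no; does)
  open import Relation.Nullary.Decidable using (T?; decidable-stable)
  open import Relation.Binary.PropositionalEquality
  open import Relation.Binary.Definitions using (tri<; tri≈; tri>)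
  open import Data.Nat.Solver using (module +-*-Solver)
  open +-*-Solver using (_:+_; _:*_; _:=_)

  private variable
    A B : Set
    P Q : A → Bool
    xs ys : List A

  -- Counting and finite sums

  does-sound : {X : Set} (x? : Dec X) → T (does x?) → X
  does-sound (yes x) _ = x

  does-complete : {X : Set} (x? : Dec X) → X → T (does x?)
  does-complete (yes _) _ = tt
  does-complete (no ¬x) x = ¬x x

  not-elim : {a : Bool} → T (not a) → ¬ T a
  not-elim {false} _ ()

  not-intro : {a : Bool} → ¬ T a → T (not a)
  not-intro {false} _ = tt
  not-intro {true} ¬a = ¬a tt

  ∧-elim : {a b : Bool} → T (a ∧ b) → T a × T b
  ∧-elim = Equivalence.to T-∧

  ∧-intro : {a b : Bool} → T a → T b → T (a ∧ b)
  ∧-intro ta tb = Equivalence.from T-∧ (ta , tb)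

  -- Defs' count P unfolds to countIn P (allTuples k n).
  countIn : (A → Bool) → List A → ℕ
  countIn P xs = length (filter (λ x → T? (P x)) xs)

  countIn-split : (P Q : A → Bool) (xs : List A) →
    countIn P xs ≡ countIn (λ x → P x ∧ Q x) xs + countIn (λ x → P x ∧ not (Q x)) xs
  countIn-split P Q [] = refl
  countIn-split P Q (x ∷ xs) with P x | Q x
  ... | false | _    = countIn-split P Q xs
  ... | true  | true  = cong suc (countIn-split P Q xs)
  ... | true  | false = trans (cong suc (countIn-split P Q xs)) (sym (+-suc _ _))

  countIn-mono : (xs : List A) → (∀ {x} → x ∈ xs → T (P x) → T (Q x)) → countIn P xs ≤ countIn Q xs
  countIn-mono [] P⇒Q = z≤n
  countIn-mono {P = P} {Q} (x ∷ xs) P⇒Q with P x in px | Q x in qx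
  ... | false | false = countIn-mono xs (P⇒Q ∘ there)
  ... | false | true  = m≤n⇒m≤1+n (countIn-mono xs (P⇒Q ∘ there))
  ... | true  | true  = s≤s (countIn-mono xs (P⇒Q ∘ there))
  ... | true  | false = ⊥-elim (subst T qx (P⇒Q (here refl) (subst T (sym px) tt)))

  countIn-cong : (xs : List A) → (∀ {x} → x ∈ xs → T (P x) → T (Q x)) → (∀ {x} → x ∈ xs → T (Q x) → T (P x)) →
    countIn P xs ≡ countIn Q xs
  countIn-cong xs P⇒Q Q⇒P = ≤-antisym (countIn-mono xs P⇒Q) (countIn-mono xs Q⇒P)

  countIn-true : (xs : List A) → countIn (λ _ → true) xs ≡ length xs
  countIn-true [] = refl
  countIn-true (x ∷ xs) = cong suc (countIn-true xs)

  countIn-none : (∀ x → ¬ T (P x)) → (xs : List A) → countIn P xs ≡ 0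
  countIn-none ¬P xs = cong length (Listₚ.filter-none (λ x → T? _) (All.universal (λ x → ¬P x) xs))

  countIn-++ : (P : A → Bool) (xs ys : List A) → countIn P (xs List.++ ys) ≡ countIn P xs + countIn P ys
  countIn-++ P xs ys = trans (cong length (Listₚ.filter-++ (λ x → T? (P x)) xs ys)) (Listₚ.length-++ (filter _ xs))

  countIn-map : (P : B → Bool) (f : A → B) (xs : List A) → countIn P (map f xs) ≡ countIn (P ∘ f) xs
  countIn-map P f [] = refl
  countIn-map P f (x ∷ xs) with P (f x)
  ... | true  = cong suc (countIn-map P f xs)
  ... | false = countIn-map P f xs

  length-≤-Unique-⊆ : Unique xs → xs ⊆ ys → length xs ≤ length ys
  length-≤-Unique-⊆ {xs = []} _ _ = z≤n
  length-≤-Unique-⊆ {xs = x ∷ xs} {ys} (x∉xs ∷ xs!) xs⊆ys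
    with us , vs , refl ← ∈-∃++ (xs⊆ys (here refl)) = begin
      suc (length xs)                ≤⟨ s≤s (length-≤-Unique-⊆ xs! xs⊆us++vs) ⟩
      suc (length (us List.++ vs))   ≡⟨ cong suc (Listₚ.length-++ us) ⟩
      suc (length us + length vs)    ≡⟨ sym (+-suc (length us) (length vs)) ⟩
      length us + suc (length vs)    ≡⟨ sym (Listₚ.length-++ us) ⟩
      length (us List.++ x ∷ vs) ∎
    where
    open ≤-Reasoning
    xs⊆us++vs : xs ⊆ us List.++ vs
    xs⊆us++vs {y} y∈xs with ∈-++⁻ us (xs⊆ys (there y∈xs))
    ... | inj₁ y∈us        = ∈-++⁺ˡ y∈us
    ... | inj₂ (here refl) = ⊥-elim (All.lookup x∉xs y∈xs refl)
    ... | inj₂ (there y∈vs) = ∈-++⁺ʳ us y∈vs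

  countIn-≤-length : Unique xs → (∀ {x} → x ∈ xs → T (P x) → x ∈ ys) → countIn P xs ≤ length ys
  countIn-≤-length {P = P} xs! P⊆ys = length-≤-Unique-⊆ (Uniqueₚ.filter⁺ (λ x → T? (P x)) xs!)
    (λ x∈ → let (x∈xs , px) = ∈-filter⁻ (λ x → T? (P x)) x∈ in P⊆ys x∈xs px)

  Unique-map⁺-on : (f : A → B) → Unique xs → (∀ {x y} → x ∈ xs → y ∈ xs → f x ≡ f y → x ≡ y) → Unique (map f xs)
  Unique-map⁺-on {xs = []} f [] _ = []
  Unique-map⁺-on {xs = x ∷ xs} f (x∉xs ∷ xs!) f-inj =
    images-differ x∉xs (λ y∈ → y∈) ∷ Unique-map⁺-on f xs! (λ x∈ y∈ → f-inj (there x∈) (there y∈))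
    where
    images-differ : ∀ {zs} → All (x ≢_) zs → zs ⊆ xs → All (f x ≢_) (map f zs)
    images-differ [] _ = []
    images-differ (x≢z ∷ x≢zs) zs⊆xs =
      (x≢z ∘ f-inj (here refl) (there (zs⊆xs (here refl)))) ∷ images-differ x≢zs (zs⊆xs ∘ there)

  module _ {P : A → Bool} {Q : B → Bool} (f : A → B) where

    countIn-≤-injection : Unique xs →
      (∀ {x y} → x ∈ xs → y ∈ xs → T (P x) → T (P y) → f x ≡ f y → x ≡ y) →
      (∀ {x} → x ∈ xs → T (P x) → f x ∈ ys × T (Q (f x))) →
      countIn P xs ≤ countIn Q ys
    countIn-≤-injection {xs} {ys} xs! f-inj f-maps = subst (_≤ countIn Q ys) (Listₚ.length-map f (filter _ xs))
      (length-≤-Unique-⊆ (Unique-map⁺-on f (Uniqueₚ.filter⁺ (λ x → T? (P x)) xs!) f-inj′) image⊆)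
      where
      P-part : ∀ {x} → x ∈ filter (λ x → T? (P x)) xs → x ∈ xs × T (P x)
      P-part = ∈-filter⁻ (λ x → T? (P x))
      f-inj′ : ∀ {x y} → x ∈ filter (λ x → T? (P x)) xs → y ∈ filter (λ x → T? (P x)) xs → f x ≡ f y → x ≡ y
      f-inj′ x∈ y∈ = let (x∈xs , px) = P-part x∈ ; (y∈xs , py) = P-part y∈ in f-inj x∈xs y∈xs px py
      image⊆ : map f (filter (λ x → T? (P x)) xs) ⊆ filter (λ y → T? (Q y)) ys
      image⊆ y∈ with x , x∈ , refl ← ∈-map⁻ f y∈ =
        let (x∈xs , px) = P-part x∈ ; (fx∈ys , qfx) = f-maps x∈xs px in ∈-filter⁺ (λ y → T? (Q y)) fx∈ys qfx

    countIn-≤-surjection : Unique ys →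
      (∀ {y} → y ∈ ys → T (Q y) → ∃[ x ] x ∈ xs × T (P x) × f x ≡ y) →
      countIn Q ys ≤ countIn P xs
    countIn-≤-surjection {ys} {xs} ys! f-onto = subst (countIn Q ys ≤_) (Listₚ.length-map f (filter _ xs))
      (countIn-≤-length ys! image)
      where
      image : ∀ {y} → y ∈ ys → T (Q y) → y ∈ map f (filter (λ x → T? (P x)) xs)
      image y∈ qy with x , x∈ , px , refl ← f-onto y∈ qy = ∈-map⁺ f (∈-filter⁺ (λ x → T? (P x)) x∈ px)

  countIn-exact : Unique xs → Unique ys → (∀ {y} → y ∈ ys → y ∈ xs × T (P y)) →
    (∀ {x} → x ∈ xs → T (P x) → x ∈ ys) → countIn P xs ≡ length ys
  countIn-exact {P = P} xs! ys! ys⊆ ⊆ys = ≤-antisym (countIn-≤-length xs! ⊆ys)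
    (length-≤-Unique-⊆ ys! λ y∈ → let (y∈xs , py) = ys⊆ y∈ in ∈-filter⁺ (λ x → T? (P x)) y∈xs py)

  sum-const : (N c : ℕ) → ∑[ i < N ] c ≡ N * c
  sum-const zero c = refl
  sum-const (suc N) c = cong (c +_) (sum-const N c)

  sum-mono : {N : ℕ} {f g : Fin N → ℕ} → (∀ i → f i ≤ g i) → sum f ≤ sum g
  sum-mono {zero} f≤g = z≤n
  sum-mono {suc N} f≤g = +-mono-≤ (f≤g Fin.zero) (sum-mono (f≤g ∘ Fin.suc))

  term≤sum : {N : ℕ} (f : Fin N → ℕ) (i : Fin N) → f i ≤ sum f
  term≤sum f Fin.zero = m≤m+n _ _
  term≤sum f (Fin.suc i) = ≤-trans (term≤sum (f ∘ Fin.suc) i) (m≤n+m _ _)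

  two-terms≤sum : {N : ℕ} (f : Fin N → ℕ) {i j : Fin N} → i ≢ j → f i + f j ≤ sum f
  two-terms≤sum f {Fin.zero} {Fin.zero} i≢j = ⊥-elim (i≢j refl)
  two-terms≤sum f {Fin.zero} {Fin.suc j} _ = +-monoʳ-≤ (f Fin.zero) (term≤sum (f ∘ Fin.suc) j)
  two-terms≤sum f {Fin.suc i} {Fin.zero} _ =
    subst (_≤ sum f) (+-comm (f Fin.zero) _) (+-monoʳ-≤ (f Fin.zero) (term≤sum (f ∘ Fin.suc) i))
  two-terms≤sum f {Fin.suc i} {Fin.suc j} i≢j =
    ≤-trans (two-terms≤sum (f ∘ Fin.suc) (i≢j ∘ cong Fin.suc)) (m≤n+m _ (f Fin.zero))

  countIn-partition : {N : ℕ} (C : Fin N → A → Bool) (P : A → Bool) (xs : List A) →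
    (∀ x → T (P x) → ∃[ i ] T (C i x)) → (∀ x {i j} → T (P x) → T (C i x) → T (C j x) → i ≡ j) →
    countIn P xs ≡ ∑[ i < N ] countIn (λ x → C i x ∧ P x) xs
  countIn-partition {N = zero} C P xs covered _ = countIn-none (λ x px → case covered x px of λ ()) xs
  countIn-partition {N = suc N} C P xs covered disjoint = begin
    countIn P xs
      ≡⟨ countIn-split P (C Fin.zero) xs ⟩
    countIn (λ x → P x ∧ C Fin.zero x) xs + countIn (λ x → P x ∧ not (C Fin.zero x)) xs
      ≡⟨ cong₂ _+_ (countIn-cong xs (λ {x} _ → swap-∧ {P x}) (λ {x} _ → swap-∧ {C Fin.zero x}))
                   (countIn-partition (C ∘ Fin.suc) _ xs covered-by-rest disjoint-rest) ⟩
    countIn (λ x → C Fin.zero x ∧ P x) xs + ∑[ i < N ] countIn (λ x → C (Fin.suc i) x ∧ (P x ∧ not (C Fin.zero x))) xs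
      ≡⟨ cong (countIn (λ x → C Fin.zero x ∧ P x) xs +_) (sum-cong-≗ drop-¬C0) ⟩
    countIn (λ x → C Fin.zero x ∧ P x) xs + ∑[ i < N ] countIn (λ x → C (Fin.suc i) x ∧ P x) xs
      ∎
    where
    open ≡-Reasoning
    swap-∧ : {a b : Bool} → T (a ∧ b) → T (b ∧ a)
    swap-∧ {a} a∧b = let (ta , tb) = ∧-elim {a} a∧b in ∧-intro tb ta
    drop-¬C0 : ∀ i → countIn (λ x → C (Fin.suc i) x ∧ (P x ∧ not (C Fin.zero x))) xs ≡ countIn (λ x → C (Fin.suc i) x ∧ P x) xs
    drop-¬C0 i = countIn-cong xs
      (λ {x} _ in-i → let (Ci , P∧¬C0) = ∧-elim {C (Fin.suc i) x} in-i in ∧-intro Ci (proj₁ (∧-elim {P x} P∧¬C0)))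
      (λ {x} _ in-i → let (Ci , Px) = ∧-elim {C (Fin.suc i) x} in-i in
                      ∧-intro Ci (∧-intro Px (not-intro λ C0 → 0≢1+n (cong toℕ (disjoint x Px C0 Ci)))))
    covered-by-rest : ∀ x → T (P x ∧ not (C Fin.zero x)) → ∃[ i ] T (C (Fin.suc i) x)
    covered-by-rest x P∧¬C0 with ∧-elim {P x} P∧¬C0
    ... | Px , ¬C0 with covered x Px
    ...   | Fin.zero , C0 = ⊥-elim (not-elim ¬C0 C0)
    ...   | Fin.suc i , Ci = i , Ci
    disjoint-rest : ∀ x {i j} → T (P x ∧ not (C Fin.zero x)) → T (C (Fin.suc i) x) → T (C (Fin.suc j) x) → i ≡ j
    disjoint-rest x P∧¬C0 Ci Cj = Finₚ.suc-injective (disjoint x (proj₁ (∧-elim {P x} P∧¬C0)) Ci Cj)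

  -- Parity

  parity : (c : ℕ) → ∃[ h ] (c ≡ h + h ⊎ c ≡ suc (h + h))
  parity zero = 0 , inj₁ refl
  parity (suc c) with parity c
  ... | h , inj₁ c≡2h   = h , inj₂ (cong suc c≡2h)
  ... | h , inj₂ c≡2h+1 = suc h , inj₁ (cong suc (trans c≡2h+1 (sym (+-suc h h))))

  double≢odd : (h g : ℕ) → h + h ≢ suc (g + g)
  double≢odd h g eq = even≢odd h g (begin
    2 * h            ≡⟨ cong (h +_) (+-identityʳ h) ⟩
    h + h            ≡⟨ eq ⟩
    suc (g + g)      ≡⟨ cong (λ x → suc (g + x)) (sym (+-identityʳ g)) ⟩
    suc (2 * g)      ∎)
    where open ≡-Reasoning

  m+m≡n+n⇒m≡n : (x y : ℕ) → x + x ≡ y + y → x ≡ y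
  m+m≡n+n⇒m≡n x y 2x≡2y = trans (n≡⌊n+n/2⌋ x) (trans (cong ℕ.⌊_/2⌋ 2x≡2y) (sym (n≡⌊n+n/2⌋ y)))

  ∣2⇒double : (x : ℕ) → 2 ∣ x → ∃[ q ] x ≡ q + q
  ∣2⇒double x (divides q x≡q*2) = q , trans x≡q*2 (trans (*-comm q 2) (cong (q +_) (+-identityʳ q)))

  double⇒∣2 : {x : ℕ} (q : ℕ) → x ≡ q + q → 2 ∣ x
  double⇒∣2 q x≡2q = divides q (trans x≡2q (trans (cong (q +_) (sym (+-identityʳ q))) (*-comm 2 q)))

  ∤2⇒odd : (x : ℕ) → ¬ (2 ∣ x) → ∃[ q ] x ≡ suc (q + q)
  ∤2⇒odd x 2∤x with parity x
  ... | q , inj₁ x≡2q = ⊥-elim (2∤x (double⇒∣2 q x≡2q))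
  ... | q , inj₂ x≡2q+1 = q , x≡2q+1

  odd-part-of-odd : {n t m : ℕ} → n ≡ 2 ^ t * m → ¬ (2 ∣ n) → m ≡ n
  odd-part-of-odd {t = zero} {m} n≡m _ = sym (trans n≡m (+-identityʳ m))
  odd-part-of-odd {t = suc t} {m} n≡2^[1+t]m 2∤n =
    ⊥-elim (2∤n (divides (2 ^ t * m) (trans n≡2^[1+t]m (trans (*-assoc 2 (2 ^ t) m) (*-comm 2 (2 ^ t * m))))))

  odd-suc⇒double : (n′ : ℕ) → ¬ (2 ∣ suc n′) → ∃[ h ] n′ ≡ h + h
  odd-suc⇒double n′ 2∤n with h , n≡ ← ∤2⇒odd (suc n′) 2∤n = h , suc-injective n≡

  even-suc⇒double : (n′ : ℕ) → 2 ∣ suc n′ → ∃[ h ] n′ ≡ h + suc h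
  even-suc⇒double n′ 2∣n with ∣2⇒double (suc n′) 2∣n
  ... | zero , ()
  ... | suc h , n≡ = h , suc-injective n≡

  odd⇒coprime-2 : (p : ℕ) → ¬ (2 ∣ p) → Coprime p 2
  odd⇒coprime-2 p 2∤p {1} _ = refl
  odd⇒coprime-2 p 2∤p {2} (2∣p , _) = ⊥-elim (2∤p 2∣p)
  odd⇒coprime-2 p 2∤p {0} (_ , 0∣2) with () ← 0∣⇒≡0 0∣2
  odd⇒coprime-2 p 2∤p {suc (suc (suc _))} (_ , 3+∣2) with s≤s (s≤s ()) ← ∣⇒≤ 3+∣2

  odd-∣-2^t*m : {p : ℕ} (t m : ℕ) → ¬ (2 ∣ p) → p ∣ 2 ^ t * m → p ∣ m
  odd-∣-2^t*m zero m 2∤p p∣m = subst (_ ∣_) (+-identityʳ m) p∣m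
  odd-∣-2^t*m {p} (suc t) m 2∤p p∣2^[1+t]m =
    odd-∣-2^t*m t m 2∤p (coprime-divisor (odd⇒coprime-2 p 2∤p) (subst (p ∣_) (*-assoc 2 (2 ^ t) m) p∣2^[1+t]m))

  -- Tuples and negation modulo k

  allTuples-complete : (k n : ℕ) (v : Tuple k n) → v ∈ allTuples k n
  allTuples-complete k zero [] = here refl
  allTuples-complete k (suc n) (a ∷ w) =
    ∈-concat⁺′ (∈-map⁺ (a ∷_) (allTuples-complete k n w)) (∈-map⁺ (λ a → map (a ∷_) (allTuples k n)) (∈-allFin a))

  allTuples-unique : (k n : ℕ) → Unique (allTuples k n)
  allTuples-unique k zero = [] ∷ []
  allTuples-unique k (suc n) = Uniqueₚ.concat⁺
    (Allₚ.map⁺ (All.universal (λ a → Uniqueₚ.map⁺ (proj₂ ∘ Vecₚ.∷-injective) (allTuples-unique k n)) (allFin k)))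
    (AllPairsₚ.map⁺ (AllPairs.map heads-differ (Uniqueₚ.allFin⁺ k)))
    where
    heads-differ : ∀ {a b} → a ≢ b → Disjoint (map (a ∷_) (allTuples k n)) (map (b ∷_) (allTuples k n))
    heads-differ a≢b (v∈a∷ , v∈b∷) with _ , _ , refl ← ∈-map⁻ _ v∈a∷ | _ , _ , eq ← ∈-map⁻ _ v∈b∷ =
      a≢b (proj₁ (Vecₚ.∷-injective eq))

  count-head-tail : {k n : ℕ} (Q : Fin k → Bool) (R : Tuple k n → Bool) →
    count {k} {suc n} (λ v → Q (head v) ∧ R (tail v)) ≡ countIn Q (allFin k) * count R
  count-head-tail {k} {n} Q R = go (allFin k)
    where
    go : (as : List (Fin k)) →
      countIn (λ v → Q (head v) ∧ R (tail v)) (concatMap (λ a → map (a ∷_) (allTuples k n)) as) ≡ countIn Q as * count R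
    go [] = refl
    go (a ∷ as) = trans (countIn-++ _ (map (a ∷_) (allTuples k n)) _)
      (trans (cong₂ _+_ (countIn-map _ (a ∷_) (allTuples k n)) (go as)) head-case)
      where
      head-case : countIn (λ w → Q a ∧ R w) (allTuples k n) + countIn Q as * count R ≡ countIn Q (a ∷ as) * count R
      head-case with Q a
      ... | true  = refl
      ... | false = cong (_+ countIn Q as * count R) (countIn-none (λ _ ()) (allTuples k n))

  count-true : (k n : ℕ) → count {k} {n} (λ _ → true) ≡ k ^ n
  count-true k zero = refl
  count-true k (suc n) = trans (count-head-tail {k} {n} (λ _ → true) (λ _ → true))
    (cong₂ _*_ (trans (countIn-true (allFin k)) (Listₚ.length-tabulate {n = k} (λ i → i))) (count-true k n))

  count-mono : {k n : ℕ} {P Q : Tuple k n → Bool} → (∀ v → T (P v) → T (Q v)) → count P ≤ count Q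
  count-mono {k} {n} P⇒Q = countIn-mono (allTuples k n) (λ {v} _ → P⇒Q v)

  count-cong : {k n : ℕ} {P Q : Tuple k n → Bool} →
    (∀ v → T (P v) → T (Q v)) → (∀ v → T (Q v) → T (P v)) → count P ≡ count Q
  count-cong P⇒Q Q⇒P = ≤-antisym (count-mono P⇒Q) (count-mono Q⇒P)

  count-bijection : {k m n : ℕ} {P : Tuple k m → Bool} {Q : Tuple k n → Bool} (f : Tuple k m → Tuple k n) →
    (∀ x → T (P x) → T (Q (f x))) →
    (∀ {x y} → T (P x) → T (P y) → f x ≡ f y → x ≡ y) →
    (∀ y → T (Q y) → ∃[ x ] T (P x) × f x ≡ y) →
    count P ≡ count Q
  count-bijection {k} {m} {n} f f-maps f-inj f-onto = ≤-antisym
    (countIn-≤-injection f (allTuples-unique k m) (λ _ _ → f-inj)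
      (λ {x} _ px → allTuples-complete k n (f x) , f-maps x px))
    (countIn-≤-surjection f (allTuples-unique k n)
      (λ {y} _ qy → let (x , px , fx≡y) = f-onto y qy in x , allTuples-complete k m x , px , fx≡y))

  module Negation {k : ℕ} where

    private
      K = suc k

    negF-zero : negF {K} Fin.zero ≡ Fin.zero
    negF-zero = Finₚ.toℕ-injective (trans (Finₚ.toℕ-fromℕ< _) (n%n≡0 K))

    toℕ-negF : (a : Fin K) → toℕ a ≢ 0 → toℕ (negF a) ≡ K ∸ toℕ a
    toℕ-negF a a≢0 = trans (Finₚ.toℕ-fromℕ< _) (m<n⇒m%n≡m (∸-monoʳ-< (n≢0⇒n>0 a≢0) (Finₚ.toℕ≤n a)))

    toℕ-negF≢0 : (a : Fin K) → toℕ a ≢ 0 → toℕ (negF a) ≢ 0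
    toℕ-negF≢0 a a≢0 negF-a≡0 = <⇒≱ (Finₚ.toℕ<n a) (m∸n≡0⇒m≤n (trans (sym (toℕ-negF a a≢0)) negF-a≡0))

    negF-involutive : (a : Fin K) → negF (negF a) ≡ a
    negF-involutive Fin.zero = trans (cong negF negF-zero) negF-zero
    negF-involutive a@(Fin.suc _) = Finₚ.toℕ-injective (begin
      toℕ (negF (negF a))  ≡⟨ toℕ-negF (negF a) (toℕ-negF≢0 a λ ()) ⟩
      K ∸ toℕ (negF a)     ≡⟨ cong (K ∸_) (toℕ-negF a λ ()) ⟩
      K ∸ (K ∸ toℕ a)      ≡⟨ m∸[m∸n]≡n (Finₚ.toℕ≤n a) ⟩
      toℕ a                ∎)
      where open ≡-Reasoning

    pw2-nonzero : (a : Fin K) → toℕ a ≢ 0 → pw2 a ≡ 2 * toℕ a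
    pw2-nonzero a a≢0 with toℕ a
    ... | zero  = ⊥-elim (a≢0 refl)
    ... | suc _ = refl

    pw2-negF : (a : Fin K) → pw2 (negF a) + pw2 a ≡ 2 * K
    pw2-negF Fin.zero = trans (cong (λ b → pw2 b + K) negF-zero) (cong (K +_) (sym (+-identityʳ K)))
    pw2-negF a@(Fin.suc _) = begin
      pw2 (negF a) + pw2 a             ≡⟨ cong (_+ pw2 a) (pw2-nonzero (negF a) (toℕ-negF≢0 a λ ())) ⟩
      2 * toℕ (negF a) + 2 * toℕ a     ≡⟨ sym (*-distribˡ-+ 2 (toℕ (negF a)) (toℕ a)) ⟩
      2 * (toℕ (negF a) + toℕ a)       ≡⟨ cong (λ x → 2 * (x + toℕ a)) (toℕ-negF a λ ()) ⟩
      2 * ((K ∸ toℕ a) + toℕ a)        ≡⟨ cong (2 *_) (m∸n+n≡m (Finₚ.toℕ≤n a)) ⟩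
      2 * K                            ∎
      where open ≡-Reasoning

    pw2-fixed : (a : Fin K) → negF a ≡ a → pw2 a ≡ K
    pw2-fixed a negF-a≡a = *-cancelˡ-≡ (pw2 a) K 2
      (trans (cong (pw2 a +_) (+-identityʳ (pw2 a))) (trans (cong (λ b → pw2 b + pw2 a) (sym negF-a≡a)) (pw2-negF a)))

    negF-fixed⇒ : (a : Fin K) → negF a ≡ a → a ≡ Fin.zero ⊎ toℕ a + toℕ a ≡ K
    negF-fixed⇒ Fin.zero _ = inj₁ refl
    negF-fixed⇒ a@(Fin.suc _) negF-a≡a =
      inj₂ (trans (cong (_+ toℕ a) (trans (sym (cong toℕ negF-a≡a)) (toℕ-negF a λ ()))) (m∸n+n≡m (Finₚ.toℕ≤n a)))

    negF-fixed⇐ : (a : Fin K) → toℕ a + toℕ a ≡ K → negF a ≡ a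
    negF-fixed⇐ Fin.zero _ = negF-zero
    negF-fixed⇐ a@(Fin.suc _) a+a≡K =
      Finₚ.toℕ-injective (trans (toℕ-negF a λ ()) (trans (cong (_∸ toℕ a) (sym a+a≡K)) (m+n∸n≡m (toℕ a) (toℕ a))))

    record Half : Set where
      field
        half : Fin K
        half+half≡K : toℕ half + toℕ half ≡ K
        half≢zero : half ≢ Fin.zero

      half-fixed : negF half ≡ half
      half-fixed = negF-fixed⇐ half half+half≡K

    half-of : 2 ∣ K → Half
    half-of 2∣K with suc h , K≡h+h ← ∣2⇒double K 2∣K = record
      { half = fromℕ< h<K
      ; half+half≡K = trans (cong₂ _+_ toℕ-half toℕ-half) (sym K≡h+h)
      ; half≢zero = λ half≡0 → 0≢1+n (trans (sym (cong toℕ half≡0)) toℕ-half)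
      }
      where
      h<K : suc h < K
      h<K = subst (suc h <_) (sym K≡h+h) (m<m+n (suc h) (s≤s z≤n))
      toℕ-half : toℕ (fromℕ< h<K) ≡ suc h
      toℕ-half = Finₚ.toℕ-fromℕ< h<K

    isFixed : Fin K → Bool
    isFixed a = does (negF a Finₚ.≟ a)

    count-fixed : countIn isFixed (allFin K) ≡ δ K
    count-fixed = count-fixed-by (2 ∣? K)
      where
      count-fixed-by : (d : Dec (2 ∣ K)) → countIn isFixed (allFin K) ≡ (if does d then 2 else 1)
      count-fixed-by (no 2∤K) = countIn-exact (Uniqueₚ.allFin⁺ K) ([] ∷ [])
        (λ { (here refl) → ∈-allFin _ , does-complete (negF Fin.zero Finₚ.≟ Fin.zero) negF-zero })
        (λ {a} _ fixed → here (only-zero a (does-sound (negF a Finₚ.≟ a) fixed)))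
        where
        only-zero : ∀ a → negF a ≡ a → a ≡ Fin.zero
        only-zero a fixed with negF-fixed⇒ a fixed
        ... | inj₁ a≡0 = a≡0
        ... | inj₂ a+a≡K = ⊥-elim (2∤K (double⇒∣2 (toℕ a) (sym a+a≡K)))
      count-fixed-by (yes 2∣K) = countIn-exact (Uniqueₚ.allFin⁺ K) (((half≢zero ∘ sym) ∷ []) ∷ ([] ∷ []))
        (λ { (here refl) → ∈-allFin _ , does-complete (negF Fin.zero Finₚ.≟ Fin.zero) negF-zero
           ; (there (here refl)) → ∈-allFin _ , does-complete (negF half Finₚ.≟ half) half-fixed })
        (λ {a} _ fixed → zero-or-half a (does-sound (negF a Finₚ.≟ a) fixed))
        where
        open Half (half-of 2∣K)
        zero-or-half : ∀ a → negF a ≡ a → a ∈ Fin.zero ∷ half ∷ []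
        zero-or-half a fixed with negF-fixed⇒ a fixed
        ... | inj₁ a≡0 = here a≡0
        ... | inj₂ a+a≡K = there (here (Finₚ.toℕ-injective (m+m≡n+n⇒m≡n _ _ (trans a+a≡K (sym half+half≡K)))))

  -- Rotations and negated reversal

  ≡-by-toList : {n : ℕ} {u v : Vec A n} → toList u ≡ toList v → u ≡ v
  ≡-by-toList {u = u} {v} eq = trans (sym (Vecₚ.cast-is-id refl u)) (Vecₚ.toList-injective refl u v eq)

  rotList : List A → List A
  rotList [] = []
  rotList (a ∷ l) = l List.++ List.[ a ]

  rotListN : ℕ → List A → List A
  rotListN zero l = l
  rotListN (suc j) l = rotListN j (rotList l)

  rotListN-++ : (xs ys : List A) → rotListN (length xs) (xs List.++ ys) ≡ ys List.++ xs
  rotListN-++ [] ys = sym (Listₚ.++-identityʳ ys)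
  rotListN-++ (x ∷ xs) ys = begin
    rotListN (length xs) ((xs List.++ ys) List.++ List.[ x ])  ≡⟨ cong (rotListN (length xs)) (Listₚ.++-assoc xs ys _) ⟩
    rotListN (length xs) (xs List.++ ys List.++ List.[ x ])    ≡⟨ rotListN-++ xs (ys List.++ List.[ x ]) ⟩
    (ys List.++ List.[ x ]) List.++ xs                          ≡⟨ Listₚ.++-assoc ys List.[ x ] xs ⟩
    ys List.++ x ∷ xs                                      ∎
    where open ≡-Reasoning

  replicate-∷ʳ : (n : ℕ) (a : A) → replicate n a ∷ʳ a ≡ a ∷ replicate n a
  replicate-∷ʳ zero a = refl
  replicate-∷ʳ (suc n) a = cong (a ∷_) (replicate-∷ʳ n a)

  module _ {k : ℕ} where

    toList-rotN : {n : ℕ} (j : ℕ) (v : Tuple k n) → toList (rotN j v) ≡ rotListN j (toList v)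
    toList-rotN zero v = refl
    toList-rotN (suc j) [] = toList-rotN j []
    toList-rotN (suc j) (a ∷ v) = trans (toList-rotN j (v ∷ʳ a)) (cong (rotListN j) (Vecₚ.toList-∷ʳ a v))

    rotN-+ : {n : ℕ} (i j : ℕ) (u : Tuple k n) → rotN (i + j) u ≡ rotN j (rotN i u)
    rotN-+ zero j u = refl
    rotN-+ (suc i) j u = rotN-+ i j (rot u)

    rotN-comm : {n : ℕ} (i j : ℕ) (u : Tuple k n) → rotN i (rotN j u) ≡ rotN j (rotN i u)
    rotN-comm i j u = trans (sym (rotN-+ j i u)) (trans (cong (λ x → rotN x u) (+-comm j i)) (rotN-+ i j u))

    rotN-suc : {n : ℕ} (j : ℕ) (u : Tuple k n) → rotN (suc j) u ≡ rot (rotN j u)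
    rotN-suc j u = trans (cong (λ x → rotN x u) (+-comm 1 j)) (rotN-+ j 1 u)

    rotN-length : {n : ℕ} (u : Tuple k n) → rotN n u ≡ u
    rotN-length {n} u = ≡-by-toList (begin
      toList (rotN n u)                                   ≡⟨ toList-rotN n u ⟩
      rotListN n (toList u)                               ≡⟨ cong (λ x → rotListN x (toList u)) (sym (Vecₚ.length-toList u)) ⟩
      rotListN (length (toList u)) (toList u)             ≡⟨ cong (rotListN (length (toList u))) (sym (Listₚ.++-identityʳ (toList u))) ⟩
      rotListN (length (toList u)) (toList u List.++ []) ≡⟨ rotListN-++ (toList u) [] ⟩
      toList u                                            ∎)
      where open ≡-Reasoning

    rotN-*-period : {n : ℕ} (p : ℕ) (u : Tuple k n) → rotN p u ≡ u → (q : ℕ) → rotN (q * p) u ≡ u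
    rotN-*-period p u rotN-p-u≡u zero = refl
    rotN-*-period p u rotN-p-u≡u (suc q) =
      trans (rotN-+ p (q * p) u) (trans (cong (rotN (q * p)) rotN-p-u≡u) (rotN-*-period p u rotN-p-u≡u q))

    rotN-%-period : {n : ℕ} (p : ℕ) .{{_ : NonZero p}} (u : Tuple k n) → rotN p u ≡ u →
      (j : ℕ) → rotN j u ≡ rotN (j % p) u
    rotN-%-period p u rotN-p-u≡u j = begin
      rotN j u                          ≡⟨ cong (λ x → rotN x u) (trans (m≡m%n+[m/n]*n j p) (+-comm (j % p) _)) ⟩
      rotN ((j / p) * p + j % p) u      ≡⟨ rotN-+ ((j / p) * p) (j % p) u ⟩
      rotN (j % p) (rotN ((j / p) * p) u) ≡⟨ cong (rotN (j % p)) (rotN-*-period p u rotN-p-u≡u (j / p)) ⟩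
      rotN (j % p) u                    ∎
      where open ≡-Reasoning

    rot-injective : {n : ℕ} (u v : Tuple k n) → rot u ≡ rot v → u ≡ v
    rot-injective [] [] _ = refl
    rot-injective (a ∷ u) (b ∷ v) eq with u≡v , refl ← Vecₚ.∷ʳ-injective u v eq = cong (a ∷_) u≡v

    rotN-injective : {n : ℕ} (j : ℕ) (u v : Tuple k n) → rotN j u ≡ rotN j v → u ≡ v
    rotN-injective zero u v eq = eq
    rotN-injective (suc j) u v eq = rot-injective u v (rotN-injective j (rot u) (rot v) eq)

    rotN-replicate : {n : ℕ} (j : ℕ) (a : Fin k) → rotN j (replicate n a) ≡ replicate n a
    rotN-replicate zero a = refl
    rotN-replicate {zero} (suc j) a = rotN-replicate j a
    rotN-replicate {suc n} (suc j) a = trans (cong (rotN j) (replicate-∷ʳ n a)) (rotN-replicate j a)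

    rotN-++-self : {h : ℕ} (j : ℕ) (x : Tuple k h) → rotN j (x ++ x) ≡ rotN j x ++ rotN j x
    rotN-++-self j x = ≡-by-toList (begin
      toList (rotN j (x ++ x))                      ≡⟨ toList-rotN j (x ++ x) ⟩
      rotListN j (toList (x ++ x))                  ≡⟨ cong (rotListN j) (Vecₚ.toList-++ x x) ⟩
      rotListN j (toList x List.++ toList x)        ≡⟨ rotListN-++-self j (toList x) ⟩
      rotListN j (toList x) List.++ rotListN j (toList x) ≡⟨ sym (cong₂ List._++_ (toList-rotN j x) (toList-rotN j x)) ⟩
      toList (rotN j x) List.++ toList (rotN j x)    ≡⟨ sym (Vecₚ.toList-++ (rotN j x) (rotN j x)) ⟩
      toList (rotN j x ++ rotN j x)                  ∎)
      where
      open ≡-Reasoning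
      rotListN-++-self : (j : ℕ) (l : List (Fin k)) → rotListN j (l List.++ l) ≡ rotListN j l List.++ rotListN j l
      rotListN-++-self zero l = refl
      rotListN-++-self (suc j) [] = rotListN-++-self j []
      rotListN-++-self (suc j) (a ∷ l) = trans (cong (rotListN j) (trans (Listₚ.++-assoc l (a ∷ l) _)
        (sym (Listₚ.++-assoc l List.[ a ] (l List.++ List.[ a ]))))) (rotListN-++-self j (l List.++ List.[ a ]))

    rotN-swap : {h : ℕ} (x y : Tuple k h) → rotN h (x ++ y) ≡ y ++ x
    rotN-swap {h} x y = ≡-by-toList (begin
      toList (rotN h (x ++ y))                          ≡⟨ toList-rotN h (x ++ y) ⟩
      rotListN h (toList (x ++ y))                      ≡⟨ cong₂ rotListN (sym (Vecₚ.length-toList x)) (Vecₚ.toList-++ x y) ⟩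
      rotListN (length (toList x)) (toList x List.++ toList y) ≡⟨ rotListN-++ (toList x) (toList y) ⟩
      toList y List.++ toList x                         ≡⟨ sym (Vecₚ.toList-++ y x) ⟩
      toList (y ++ x)                                   ∎)
      where open ≡-Reasoning

    rotN-fixed⇒halves-equal : {h : ℕ} (m : ℕ) → m ∣ h → (x y : Tuple k h) → rotN m (x ++ y) ≡ x ++ y → y ≡ x
    rotN-fixed⇒halves-equal {h} m (divides q h≡q*m) x y rotN-m≡ = Vecₚ.++-injectiveˡ y x (begin
      y ++ x                ≡⟨ sym (rotN-swap x y) ⟩
      rotN h (x ++ y)       ≡⟨ cong (λ j → rotN j (x ++ y)) h≡q*m ⟩
      rotN (q * m) (x ++ y) ≡⟨ rotN-*-period m (x ++ y) rotN-m≡ q ⟩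
      x ++ y                ∎)
      where open ≡-Reasoning

  module NegatedReversal {k : ℕ} where

    open Negation {k}
    private
      K = suc k

    negRev-involutive : {n : ℕ} (v : Tuple K n) → negRev (negRev v) ≡ v
    negRev-involutive v = begin
      Vec.map negF (Vec.reverse (Vec.map negF (Vec.reverse v)))  ≡⟨ cong (Vec.map negF) (sym (Vecₚ.map-reverse negF (Vec.reverse v))) ⟩
      Vec.map negF (Vec.map negF (Vec.reverse (Vec.reverse v)))  ≡⟨ sym (Vecₚ.map-∘ negF negF _) ⟩
      Vec.map (negF ∘ negF) (Vec.reverse (Vec.reverse v))        ≡⟨ Vecₚ.map-cong negF-involutive _ ⟩
      Vec.map (λ a → a) (Vec.reverse (Vec.reverse v))            ≡⟨ Vecₚ.map-id _ ⟩
      Vec.reverse (Vec.reverse v)                                ≡⟨ Vecₚ.reverse-involutive v ⟩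
      v                                                          ∎
      where open ≡-Reasoning

    negRev-injective : {n : ℕ} {u v : Tuple K n} → negRev u ≡ negRev v → u ≡ v
    negRev-injective {u = u} {v} eq = trans (sym (negRev-involutive u)) (trans (cong negRev eq) (negRev-involutive v))

    negRev-∷ : {n : ℕ} (a : Fin K) (w : Tuple K n) → negRev (a ∷ w) ≡ negRev w ∷ʳ negF a
    negRev-∷ a w = trans (cong (Vec.map negF) (Vecₚ.reverse-∷ a w)) (Vecₚ.map-∷ʳ negF a (Vec.reverse w))

    negRev-∷ʳ : {n : ℕ} (w : Tuple K n) (a : Fin K) → negRev (w ∷ʳ a) ≡ negF a ∷ negRev w
    negRev-∷ʳ w a = negRev-injective (begin
      negRev (negRev (w ∷ʳ a))                    ≡⟨ negRev-involutive (w ∷ʳ a) ⟩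
      w ∷ʳ a                                      ≡⟨ sym (cong₂ _∷ʳ_ (negRev-involutive w) (negF-involutive a)) ⟩
      negRev (negRev w) ∷ʳ negF (negF a)          ≡⟨ sym (negRev-∷ (negF a) (negRev w)) ⟩
      negRev (negF a ∷ negRev w)                  ∎)
      where open ≡-Reasoning

    rot-negRev-rot : {n : ℕ} (u : Tuple K n) → rot (negRev (rot u)) ≡ negRev u
    rot-negRev-rot [] = refl
    rot-negRev-rot (a ∷ w) = trans (cong rot (negRev-∷ʳ w a)) (sym (negRev-∷ a w))

    rotN-negRev-rotN : {n : ℕ} (j : ℕ) (u : Tuple K n) → rotN j (negRev (rotN j u)) ≡ negRev u
    rotN-negRev-rotN zero u = refl
    rotN-negRev-rotN (suc j) u = begin
      rotN (suc j) (negRev (rotN (suc j) u))  ≡⟨ cong (rotN (suc j) ∘ negRev) (rotN-suc j u) ⟩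
      rotN j (rot (negRev (rot (rotN j u))))  ≡⟨ cong (rotN j) (rot-negRev-rot (rotN j u)) ⟩
      rotN j (negRev (rotN j u))              ≡⟨ rotN-negRev-rotN j u ⟩
      negRev u                                ∎
      where open ≡-Reasoning

    negRev-replicate : (n : ℕ) (a : Fin K) → negRev (replicate n a) ≡ replicate n (negF a)
    negRev-replicate n a = trans (cong (Vec.map negF) (reverse-replicate n)) (Vecₚ.map-replicate negF a n)
      where
      reverse-replicate : ∀ n → Vec.reverse (replicate n a) ≡ replicate n a
      reverse-replicate zero = refl
      reverse-replicate (suc n) =
        trans (Vecₚ.reverse-∷ a (replicate n a)) (trans (cong (_∷ʳ a) (reverse-replicate n)) (replicate-∷ʳ n a))

    negRevList : List (Fin K) → List (Fin K)
    negRevList l = List.map negF (List.reverse l)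

    toList-negRev : {n : ℕ} (v : Tuple K n) → toList (negRev v) ≡ negRevList (toList v)
    toList-negRev v = trans (Vecₚ.toList-map negF (Vec.reverse v)) (cong (List.map negF) (Vecₚ.toList-reverse v))

    negRevList-++ : (xs ys : List (Fin K)) → negRevList (xs List.++ ys) ≡ negRevList ys List.++ negRevList xs
    negRevList-++ xs ys = trans (cong (List.map negF) (Listₚ.reverse-++ xs ys)) (Listₚ.map-++ negF (List.reverse ys) (List.reverse xs))

    negRev-++-by-toList : {h h′ : ℕ} (x : Tuple K h) (y : Tuple K h′) (z : Tuple K (h + h′)) →
      toList z ≡ toList (negRev y) List.++ toList (negRev x) → negRev (x ++ y) ≡ z
    negRev-++-by-toList x y z z≡ = ≡-by-toList (begin
      toList (negRev (x ++ y))                             ≡⟨ toList-negRev (x ++ y) ⟩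
      negRevList (toList (x ++ y))                         ≡⟨ cong negRevList (Vecₚ.toList-++ x y) ⟩
      negRevList (toList x List.++ toList y)               ≡⟨ negRevList-++ (toList x) (toList y) ⟩
      negRevList (toList y) List.++ negRevList (toList x)  ≡⟨ sym (cong₂ List._++_ (toList-negRev y) (toList-negRev x)) ⟩
      toList (negRev y) List.++ toList (negRev x)          ≡⟨ sym z≡ ⟩
      toList z                                             ∎)
      where open ≡-Reasoning

    negRev-++ : {h : ℕ} (x y : Tuple K h) → negRev (x ++ y) ≡ negRev y ++ negRev x
    negRev-++ x y = negRev-++-by-toList x y _ (Vecₚ.toList-++ (negRev y) (negRev x))

    negRev-++-∷ : {h : ℕ} (x : Tuple K h) (b : Fin K) (y : Tuple K h) →
      negRev (x ++ (b ∷ y)) ≡ negRev y ++ (negF b ∷ negRev x)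
    negRev-++-∷ x b y = negRev-++-by-toList x (b ∷ y) _ (begin
      toList (negRev y ++ (negF b ∷ negRev x))                    ≡⟨ Vecₚ.toList-++ (negRev y) _ ⟩
      toList (negRev y) List.++ negF b ∷ toList (negRev x)   ≡⟨ sym (Listₚ.++-assoc (toList (negRev y)) _ _) ⟩
      (toList (negRev y) List.++ List.[ negF b ]) List.++ toList (negRev x)
                                                                  ≡⟨ cong (List._++ toList (negRev x)) (sym (Vecₚ.toList-∷ʳ (negF b) (negRev y))) ⟩
      toList (negRev y ∷ʳ negF b) List.++ toList (negRev x)        ≡⟨ sym (cong (λ v → toList v List.++ toList (negRev x)) (negRev-∷ b y)) ⟩
      toList (negRev (b ∷ y)) List.++ toList (negRev x)           ∎)
      where open ≡-Reasoning

    pw2T-∷ʳ : {n : ℕ} (w : Tuple K n) (a : Fin K) → pw2T (w ∷ʳ a) ≡ pw2T w + pw2 a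
    pw2T-∷ʳ [] a = +-comm (pw2 a) 0
    pw2T-∷ʳ (b ∷ w) a = trans (cong (pw2 b +_) (pw2T-∷ʳ w a)) (sym (+-assoc (pw2 b) _ _))

    pw2T-rotN : {n : ℕ} (j : ℕ) (v : Tuple K n) → pw2T (rotN j v) ≡ pw2T v
    pw2T-rotN zero v = refl
    pw2T-rotN (suc j) [] = pw2T-rotN j []
    pw2T-rotN (suc j) (a ∷ w) = trans (pw2T-rotN j (w ∷ʳ a)) (trans (pw2T-∷ʳ w a) (+-comm (pw2T w) (pw2 a)))

    pw2T-negRev : {n : ℕ} (v : Tuple K n) → pw2T (negRev v) + pw2T v ≡ n * (2 * K)
    pw2T-negRev [] = refl
    pw2T-negRev {suc n} (a ∷ w) = begin
      pw2T (negRev (a ∷ w)) + (pw2 a + pw2T w)           ≡⟨ cong (λ v → pw2T v + (pw2 a + pw2T w)) (negRev-∷ a w) ⟩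
      pw2T (negRev w ∷ʳ negF a) + (pw2 a + pw2T w)       ≡⟨ cong (_+ (pw2 a + pw2T w)) (pw2T-∷ʳ (negRev w) (negF a)) ⟩
      (pw2T (negRev w) + pw2 (negF a)) + (pw2 a + pw2T w) ≡⟨ +-*-Solver.solve 4 (λ x y z t → (x :+ y) :+ (z :+ t) := (y :+ z) :+ (x :+ t)) refl
                                                             (pw2T (negRev w)) (pw2 (negF a)) (pw2 a) (pw2T w) ⟩
      (pw2 (negF a) + pw2 a) + (pw2T (negRev w) + pw2T w) ≡⟨ cong₂ _+_ (pw2-negF a) (pw2T-negRev w) ⟩
      2 * K + n * (2 * K)                                 ∎
      where open ≡-Reasoning

    pw2T-replicate : (n : ℕ) (a : Fin K) → pw2T (replicate n a) ≡ n * pw2 a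
    pw2T-replicate zero a = refl
    pw2T-replicate (suc n) a = cong (pw2 a +_) (pw2T-replicate n a)

  -- Circuits and their periods

  module Circuit {k n′ : ℕ} where

    private
      n = suc n′

    inCircuit⇒ : (u v : Tuple k n) → T (inCircuit u v) → ∃[ j ] rotN j u ≡ v
    inCircuit⇒ u v u~v with j , _ , rotN-j-u≡v ← find (Anyₚ.any⁻ (λ j → does (rotN j u ≟T v)) (upTo n) u~v) =
      j , does-sound (rotN j u ≟T v) rotN-j-u≡v

    ⇒inCircuit : (u v : Tuple k n) (j : ℕ) → rotN j u ≡ v → T (inCircuit u v)
    ⇒inCircuit u v j rotN-j-u≡v = Anyₚ.any⁺ (λ j → does (rotN j u ≟T v)) (lose (∈-upTo⁺ (m%n<n j n))
      (does-complete (rotN (j % n) u ≟T v) (trans (sym (rotN-%-period n u (rotN-length u) j)) rotN-j-u≡v)))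

    inCircuit-refl : (u : Tuple k n) → T (inCircuit u u)
    inCircuit-refl u = ⇒inCircuit u u 0 refl

    inCircuit-sym : (u v : Tuple k n) → T (inCircuit u v) → T (inCircuit v u)
    inCircuit-sym u v u~v with j , refl ← inCircuit⇒ u v u~v = ⇒inCircuit (rotN j u) u (j * n′) (begin
      rotN (j * n′) (rotN j u)  ≡⟨ sym (rotN-+ j (j * n′) u) ⟩
      rotN (j + j * n′) u       ≡⟨ cong (λ x → rotN x u) (sym (*-suc j n′)) ⟩
      rotN (j * n) u            ≡⟨ rotN-*-period n u (rotN-length u) j ⟩
      u                         ∎)
      where open ≡-Reasoning

    inCircuit-trans : (u v w : Tuple k n) → T (inCircuit u v) → T (inCircuit v w) → T (inCircuit u w)
    inCircuit-trans u v w u~v v~w with i , refl ← inCircuit⇒ u v u~v | j , refl ← inCircuit⇒ v w v~w =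
      ⇒inCircuit u _ (i + j) (rotN-+ i j u)

    inCircuit-rotN : (u : Tuple k n) (j : ℕ) → T (inCircuit u (rotN j u))
    inCircuit-rotN u j = ⇒inCircuit u _ j refl

    countOn : Tuple k n → (Tuple k n → Bool) → ℕ
    countOn u P = count (λ v → inCircuit u v ∧ P v)

    countOn-cong : (u : Tuple k n) {P Q : Tuple k n → Bool} →
      (∀ v → T (inCircuit u v) → T (P v) → T (Q v)) → (∀ v → T (inCircuit u v) → T (Q v) → T (P v)) →
      countOn u P ≡ countOn u Q
    countOn-cong u {P} {Q} P⇒Q Q⇒P = count-cong {P = λ v → inCircuit u v ∧ P v} {Q = λ v → inCircuit u v ∧ Q v}
      (λ v on-u → let (u~v , Pv) = ∧-elim {inCircuit u v} on-u in ∧-intro u~v (P⇒Q v u~v Pv))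
      (λ v on-u → let (u~v , Qv) = ∧-elim {inCircuit u v} on-u in ∧-intro u~v (Q⇒P v u~v Qv))

    countOn-invariant : (u v : Tuple k n) (P : Tuple k n → Bool) → T (inCircuit u v) → countOn u P ≡ countOn v P
    countOn-invariant u v P u~v = count-cong {P = λ w → inCircuit u w ∧ P w} {Q = λ w → inCircuit v w ∧ P w}
      (λ w on-u → let (u~w , Pw) = ∧-elim {inCircuit u w} on-u in ∧-intro (inCircuit-trans v u w (inCircuit-sym u v u~v) u~w) Pw)
      (λ w on-v → let (v~w , Pw) = ∧-elim {inCircuit v w} on-v in ∧-intro (inCircuit-trans u v w u~v v~w) Pw)

    countOn≤size : (u : Tuple k n) (P : Tuple k n → Bool) → countOn u P ≤ count (inCircuit u)
    countOn≤size u P = count-mono {P = λ v → inCircuit u v ∧ P v} {Q = inCircuit u} (λ v → proj₁ ∘ ∧-elim {inCircuit u v})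

    record Period (u : Tuple k n) : Set where
      field
        p-1 : ℕ
        rotN-period : rotN (suc p-1) u ≡ u
        period-minimal : ∀ j → j < p-1 → rotN (suc j) u ≢ u

    smallest-period-below : (u : Tuple k n) (b : ℕ) →
      (∃[ j ] rotN (suc j) u ≡ u × (∀ i → i < j → rotN (suc i) u ≢ u)) ⊎ (∀ i → i < b → rotN (suc i) u ≢ u)
    smallest-period-below u zero = inj₂ (λ _ ())
    smallest-period-below u (suc b) with smallest-period-below u b
    ... | inj₁ found = inj₁ found
    ... | inj₂ none-below with rotN (suc b) u ≟T u
    ...   | yes fixed = inj₁ (b , fixed , none-below)
    ...   | no ¬fixed = inj₂ λ i i<1+b → case m≤n⇒m<n∨m≡n (s≤s⁻¹ i<1+b) of λ where
            (inj₁ i<b) → none-below i i<b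
            (inj₂ refl) → ¬fixed

    period : (u : Tuple k n) → Period u
    period u with smallest-period-below u n
    ... | inj₁ (p-1 , fixed , minimal) = record { p-1 = p-1 ; rotN-period = fixed ; period-minimal = minimal }
    ... | inj₂ none = ⊥-elim (none n′ ≤-refl (rotN-length u))

    module Periodic (u : Tuple k n) (π : Period u) where

      open Period π public

      p : ℕ
      p = suc p-1

      rotN-% : (j : ℕ) → rotN j u ≡ rotN (j % p) u
      rotN-% = rotN-%-period p u rotN-period

      rotN-≡-below-period : (i j : ℕ) → j < p → i ≤ j → rotN i u ≡ rotN j u → i ≡ j
      rotN-≡-below-period i j j<p i≤j rotN-i≡rotN-j with j ∸ i in j∸i≡
      ... | zero  = ≤-antisym i≤j (m∸n≡0⇒m≤n j∸i≡)
      ... | suc d = ⊥-elim (period-minimal d d<p-1 (rotN-injective i _ _ (begin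
        rotN i (rotN (suc d) u)  ≡⟨ rotN-comm i (suc d) u ⟩
        rotN (suc d) (rotN i u)  ≡⟨ sym (rotN-+ i (suc d) u) ⟩
        rotN (i + suc d) u       ≡⟨ cong (λ x → rotN (i + x) u) (sym j∸i≡) ⟩
        rotN (i + (j ∸ i)) u     ≡⟨ cong (λ x → rotN x u) (m+[n∸m]≡n i≤j) ⟩
        rotN j u                 ≡⟨ sym rotN-i≡rotN-j ⟩
        rotN i u                 ∎)))
        where
        open ≡-Reasoning
        d<p-1 : d < p-1
        d<p-1 = s≤s⁻¹ (≤-<-trans (subst (_≤ j) j∸i≡ (m∸n≤m j i)) j<p)

      rotN-≡⇒%-≡ : (i j : ℕ) → rotN i u ≡ rotN j u → i % p ≡ j % p
      rotN-≡⇒%-≡ i j rotN-i≡rotN-j with ≤-total (i % p) (j % p)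
      ... | inj₁ i≤j = rotN-≡-below-period _ _ (m%n<n j p) i≤j (trans (sym (rotN-% i)) (trans rotN-i≡rotN-j (rotN-% j)))
      ... | inj₂ j≤i = sym (rotN-≡-below-period _ _ (m%n<n i p) j≤i (trans (sym (rotN-% j)) (trans (sym rotN-i≡rotN-j) (rotN-% i))))

      %-≡⇒rotN-≡ : (i j : ℕ) → i % p ≡ j % p → rotN i u ≡ rotN j u
      %-≡⇒rotN-≡ i j i≡j = trans (rotN-% i) (trans (cong (λ x → rotN x u) i≡j) (sym (rotN-% j)))

      period-∣ : (j : ℕ) → rotN j u ≡ u → p ∣ j
      period-∣ j rotN-j-u≡u = m%n≡0⇒n∣m j p (rotN-≡⇒%-≡ j 0 rotN-j-u≡u)

      count-along-circuit : (R : Tuple k n → Bool) → countOn u R ≡ countIn (λ j → R (rotN j u)) (upTo p)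
      count-along-circuit R = ≤-antisym
        (countIn-≤-surjection (λ j → rotN j u) (allTuples-unique k n) preimage)
        (countIn-≤-injection (λ j → rotN j u) (Uniqueₚ.upTo⁺ p) injective
          (λ {j} _ Rj → allTuples-complete k n _ , ∧-intro (inCircuit-rotN u j) Rj))
        where
        preimage : ∀ {v} → v ∈ allTuples k n → T (inCircuit u v ∧ R v) → ∃[ j ] j ∈ upTo p × T (R (rotN j u)) × rotN j u ≡ v
        preimage {v} _ on-circuit with j , refl ← inCircuit⇒ u v (proj₁ (∧-elim on-circuit)) =
          j % p , ∈-upTo⁺ (m%n<n j p) , subst (T ∘ R) (rotN-% j) (proj₂ (∧-elim on-circuit)) , sym (rotN-% j)
        injective : ∀ {i j} → i ∈ upTo p → j ∈ upTo p → T (R (rotN i u)) → T (R (rotN j u)) → rotN i u ≡ rotN j u → i ≡ j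
        injective {i} {j} i∈ j∈ _ _ rotN-i≡rotN-j = begin
          i      ≡⟨ sym (m<n⇒m%n≡m (∈-upTo⁻ i∈)) ⟩
          i % p  ≡⟨ rotN-≡⇒%-≡ i j rotN-i≡rotN-j ⟩
          j % p  ≡⟨ m<n⇒m%n≡m (∈-upTo⁻ j∈) ⟩
          j      ∎
          where open ≡-Reasoning

      circuit-size : count (inCircuit u) ≡ p
      circuit-size = begin
        count (inCircuit u)                       ≡⟨ count-cong {P = inCircuit u} {Q = λ v → inCircuit u v ∧ true}
                                                       (λ v u~v → ∧-intro u~v tt) (λ v → proj₁ ∘ ∧-elim) ⟩
        count (λ v → inCircuit u v ∧ true)        ≡⟨ count-along-circuit (λ _ → true) ⟩
        countIn (λ _ → true) (upTo p)             ≡⟨ countIn-true (upTo p) ⟩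
        length (upTo p)                           ≡⟨ Listₚ.length-upTo p ⟩
        p                                         ∎
        where open ≡-Reasoning

    circuit-size≤n : (u : Tuple k n) → count (inCircuit u) ≤ n
    circuit-size≤n u = subst (_≤ n) (sym circuit-size) (∣⇒≤ (period-∣ n (rotN-length u)))
      where open Periodic u (period u)

  -- Negasymmetric circuits

  module HalvingModulo (p-1 : ℕ) where

    p : ℕ
    p = suc p-1

    solutions : (ℕ → ℕ) → ℕ → ℕ
    solutions f c = countIn (λ j → does (f j ℕ.≟ c)) (upTo p)

    residues : (ℕ → ℕ) → ℕ → ℕ
    residues f c = countIn (λ j → does (f j % p ℕ.≟ c)) (upTo p)

    twice twice+1 : ℕ → ℕ
    twice j = j + j
    twice+1 j = suc (j + j)

    unique-solution : (f : ℕ → ℕ) {c h : ℕ} → h < p → f h ≡ c → (∀ j → f j ≡ c → j ≡ h) → solutions f c ≡ 1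
    unique-solution f {c} h<p fh≡c only-h = countIn-exact (Uniqueₚ.upTo⁺ p) ([] ∷ [])
      (λ { (here refl) → ∈-upTo⁺ h<p , does-complete (f _ ℕ.≟ c) fh≡c })
      (λ {j} _ fj≡c → here (only-h j (does-sound (f j ℕ.≟ c) fj≡c)))

    no-solution : (f : ℕ → ℕ) {c : ℕ} → (∀ j → f j ≢ c) → solutions f c ≡ 0
    no-solution f {c} none = countIn-none (λ j fj≡c → none j (does-sound (f j ℕ.≟ c) fj≡c)) (upTo p)

    half< : (h : ℕ) → h + h < p + p → h < p
    half< h 2h<2p = ≰⇒> λ p≤h → <⇒≱ 2h<2p (+-mono-≤ p≤h p≤h)

    even-or-odd-solution : (c : ℕ) → c < p + p → solutions twice c + solutions twice+1 c ≡ 1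
    even-or-odd-solution c c<2p with parity c
    ... | h , inj₁ refl = cong₂ _+_
      (unique-solution twice (half< h c<2p) refl (λ j → m+m≡n+n⇒m≡n j h))
      (no-solution twice+1 (λ j 2j+1≡2h → double≢odd h j (sym 2j+1≡2h)))
    ... | h , inj₂ refl = cong₂ _+_
      (no-solution twice (λ j 2j≡2h+1 → double≢odd j h 2j≡2h+1))
      (unique-solution twice+1 (half< h (<-trans (n<1+n _) c<2p)) refl (λ j → m+m≡n+n⇒m≡n j h ∘ suc-injective))

    below-2p-mod : {x c : ℕ} → x < p + p → c < p → x % p ≡ c → x ≡ c ⊎ x ≡ c + p
    below-2p-mod {x} {c} x<2p c<p x%p≡c with x ℕ.<? p
    ... | yes x<p = inj₁ (trans (sym (m<n⇒m%n≡m x<p)) x%p≡c)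
    ... | no x≮p = inj₂ (begin
      x                ≡⟨ sym (m∸n+n≡m p≤x) ⟩
      (x ∸ p) + p      ≡⟨ cong (_+ p) (sym (m<n⇒m%n≡m x∸p<p)) ⟩
      (x ∸ p) % p + p  ≡⟨ cong (_+ p) (sym ([m+n]%n≡m%n (x ∸ p) p)) ⟩
      ((x ∸ p) + p) % p + p ≡⟨ cong (λ y → y % p + p) (m∸n+n≡m p≤x) ⟩
      x % p + p        ≡⟨ cong (_+ p) x%p≡c ⟩
      c + p            ∎)
      where
      open ≡-Reasoning
      p≤x : p ≤ x
      p≤x = ≮⇒≥ x≮p
      x∸p<p : x ∸ p < p
      x∸p<p = subst (x ∸ p <_) (m+n∸n≡m p p) (∸-monoˡ-< x<2p p≤x)

    residues-as-solutions : (f : ℕ → ℕ) → (∀ j → j < p → f j < p + p) → (c : ℕ) → c < p →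
      residues f c ≡ solutions f c + solutions f (c + p)
    residues-as-solutions f f<2p c c<p =
      trans (countIn-split (λ j → does (f j % p ℕ.≟ c)) (λ j → does (f j ℕ.≟ c)) (upTo p)) (cong₂ _+_
      (countIn-cong (upTo p) (λ _ → proj₂ ∘ ∧-elim)
                    (λ {j} _ fj≡c → ∧-intro (does-complete (f j % p ℕ.≟ c) (%-of (inj₁ (does-sound (f j ℕ.≟ c) fj≡c)))) fj≡c))
      (countIn-cong (upTo p) (λ {j} j∈ → wraps j (∈-upTo⁻ j∈) ∘ ∧-elim)
                    (λ {j} _ fj≡c+p → wrapped j (does-sound (f j ℕ.≟ c + p) fj≡c+p))))
      where
      %-of : ∀ {x} → x ≡ c ⊎ x ≡ c + p → x % p ≡ c
      %-of (inj₁ refl) = m<n⇒m%n≡m c<p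
      %-of (inj₂ refl) = trans ([m+n]%n≡m%n c p) (m<n⇒m%n≡m c<p)
      wraps : ∀ j → j < p → T (does (f j % p ℕ.≟ c)) × T (not (does (f j ℕ.≟ c))) → T (does (f j ℕ.≟ c + p))
      wraps j j<p (fj%p≡c , fj≢c) with below-2p-mod (f<2p j j<p) c<p (does-sound (f j % p ℕ.≟ c) fj%p≡c)
      ... | inj₁ fj≡c = ⊥-elim (does-sound (¬? (f j ℕ.≟ c)) fj≢c fj≡c)
      ... | inj₂ fj≡c+p = does-complete (f j ℕ.≟ c + p) fj≡c+p
      wrapped : ∀ j → f j ≡ c + p → T (does (f j % p ℕ.≟ c) ∧ not (does (f j ℕ.≟ c)))
      wrapped j fj≡c+p = ∧-intro (does-complete (f j % p ℕ.≟ c) (%-of (inj₂ fj≡c+p)))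
        (does-complete (¬? (f j ℕ.≟ c)) λ fj≡c → <⇒≢ (m<m+n c (s≤s z≤n)) (trans (sym fj≡c) fj≡c+p))

    twice<2p : ∀ j → j < p → twice j < p + p
    twice<2p j j<p = +-mono-< j<p j<p

    twice+1<2p : ∀ j → j < p → twice+1 j < p + p
    twice+1<2p j j<p = subst (_≤ p + p) (cong suc (+-suc j j)) (+-mono-≤ j<p j<p)

    residues-twice-total : (c : ℕ) → c < p → residues twice c + residues twice+1 c ≡ 2
    residues-twice-total c c<p = begin
      residues twice c + residues twice+1 c
        ≡⟨ cong₂ _+_ (residues-as-solutions twice twice<2p c c<p) (residues-as-solutions twice+1 twice+1<2p c c<p) ⟩
      (solutions twice c + solutions twice (c + p)) + (solutions twice+1 c + solutions twice+1 (c + p))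
        ≡⟨ +-*-Solver.solve 4 (λ a b x y → (a :+ b) :+ (x :+ y) := (a :+ x) :+ (b :+ y)) refl
             (solutions twice c) (solutions twice (c + p)) (solutions twice+1 c) (solutions twice+1 (c + p)) ⟩
      (solutions twice c + solutions twice+1 c) + (solutions twice (c + p) + solutions twice+1 (c + p))
        ≡⟨ cong₂ _+_ (even-or-odd-solution c (<-≤-trans c<p (m≤m+n p p))) (even-or-odd-solution (c + p) (+-monoˡ-< p c<p)) ⟩
      2 ∎
      where open ≡-Reasoning

    residues-twice-even-period : (q : ℕ) → p ≡ q + q → (c : ℕ) → c < p → residues twice c ≢ 1
    residues-twice-even-period q p≡2q c c<p residues≡1 with parity c
    ... | h , inj₁ refl = 1+n≢n (begin
      2
        ≡⟨ cong₂ _+_ (sym (unique-solution twice (half< h (<-≤-trans c<p (m≤m+n p p))) refl (λ j → m+m≡n+n⇒m≡n j h)))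
                     (sym (unique-solution twice h+q<p 2[h+q]≡c+p (λ j eq → m+m≡n+n⇒m≡n j (h + q) (trans eq (sym 2[h+q]≡c+p))))) ⟩
      solutions twice (h + h) + solutions twice (h + h + p) ≡⟨ sym (residues-as-solutions twice twice<2p (h + h) c<p) ⟩
      residues twice (h + h)                              ≡⟨ residues≡1 ⟩
      1                                                   ∎)
      where
      open ≡-Reasoning
      2[h+q]≡c+p : twice (h + q) ≡ h + h + p
      2[h+q]≡c+p = trans (+-*-Solver.solve 2 (λ h q → (h :+ q) :+ (h :+ q) := (h :+ h) :+ (q :+ q)) refl h q) (cong (h + h +_) (sym p≡2q))
      h+q<p : h + q < p
      h+q<p = half< (h + q) (subst (_< p + p) (sym 2[h+q]≡c+p) (+-monoˡ-< p c<p))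
    ... | h , inj₂ refl = 0≢1+n (begin
      0                                                 ≡⟨ sym (cong₂ _+_ (no-solution twice (λ j → double≢odd j h)) (no-solution twice odd+p)) ⟩
      solutions twice c + solutions twice (c + p)       ≡⟨ sym (residues-as-solutions twice twice<2p c c<p) ⟩
      residues twice c                                  ≡⟨ residues≡1 ⟩
      1                                                 ∎)
      where
      open ≡-Reasoning
      odd+p : ∀ j → twice j ≢ suc (h + h) + p
      odd+p j eq = double≢odd j (h + q) (trans eq (cong suc (trans (cong (h + h +_) p≡2q)
        (+-*-Solver.solve 2 (λ h q → (h :+ h) :+ (q :+ q) := (h :+ q) :+ (h :+ q)) refl h q))))

    residues-twice-odd-period : (q : ℕ) → p ≡ suc (q + q) → residues twice 0 ≡ 1
    residues-twice-odd-period q p≡2q+1 = trans (residues-as-solutions twice twice<2p 0 (s≤s z≤n)) (cong₂ _+_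
      (unique-solution twice (s≤s z≤n) refl (λ j → m+m≡n+n⇒m≡n j 0))
      (no-solution twice (λ j 2j≡p → double≢odd j q (trans 2j≡p p≡2q+1))))

  isRotNegasym : {k n : ℕ} → Tuple (suc k) n → Bool
  isRotNegasym v = does (rot v ≟T negRev v)

  module NegasymmetricCircuit {k n′ : ℕ} (u : Tuple (suc k) (suc n′)) (c : ℕ) (negRev-u≡ : negRev u ≡ rotN c u) where

    open NegatedReversal {k}
    open Circuit {suc k} {n′}
    open Periodic u (period u) public
    open HalvingModulo (Period.p-1 (period u)) using (residues; twice; twice+1; residues-twice-total; residues-twice-even-period; residues-twice-odd-period)

    rotN-negasym⇔ : (j : ℕ) → rotN j u ≡ negRev (rotN j u) ⇔ (j + j) % p ≡ c % p
    rotN-negasym⇔ j = mk⇔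
      (λ negasym → rotN-≡⇒%-≡ (j + j) c (begin
        rotN (j + j) u                  ≡⟨ rotN-+ j j u ⟩
        rotN j (rotN j u)               ≡⟨ cong (rotN j) negasym ⟩
        rotN j (negRev (rotN j u))      ≡⟨ rotN-negRev-rotN j u ⟩
        negRev u                        ≡⟨ negRev-u≡ ⟩
        rotN c u                        ∎))
      (λ 2j≡c → rotN-injective j _ _ (begin
        rotN j (rotN j u)               ≡⟨ sym (rotN-+ j j u) ⟩
        rotN (j + j) u                  ≡⟨ %-≡⇒rotN-≡ (j + j) c 2j≡c ⟩
        rotN c u                        ≡⟨ sym negRev-u≡ ⟩
        negRev u                        ≡⟨ sym (rotN-negRev-rotN j u) ⟩
        rotN j (negRev (rotN j u))      ∎))
      where open ≡-Reasoning

    rotN-rotNegasym⇔ : (j : ℕ) → rot (rotN j u) ≡ negRev (rotN j u) ⇔ suc (j + j) % p ≡ c % p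
    rotN-rotNegasym⇔ j = mk⇔
      (λ rotNegasym → rotN-≡⇒%-≡ (suc (j + j)) c (begin
        rotN (suc j + j) u              ≡⟨ rotN-+ (suc j) j u ⟩
        rotN j (rotN (suc j) u)         ≡⟨ cong (rotN j) (trans (rotN-suc j u) rotNegasym) ⟩
        rotN j (negRev (rotN j u))      ≡⟨ rotN-negRev-rotN j u ⟩
        negRev u                        ≡⟨ negRev-u≡ ⟩
        rotN c u                        ∎))
      (λ 2j+1≡c → rotN-injective j _ _ (begin
        rotN j (rot (rotN j u))         ≡⟨ cong (rotN j) (sym (rotN-suc j u)) ⟩
        rotN j (rotN (suc j) u)         ≡⟨ sym (rotN-+ (suc j) j u) ⟩
        rotN (suc j + j) u              ≡⟨ %-≡⇒rotN-≡ (suc (j + j)) c 2j+1≡c ⟩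
        rotN c u                        ≡⟨ sym negRev-u≡ ⟩
        negRev u                        ≡⟨ sym (rotN-negRev-rotN j u) ⟩
        rotN j (negRev (rotN j u))      ∎))
      where open ≡-Reasoning

    negasymEdgeCount≡residues : negasymEdgeCount u ≡ residues twice (c % p)
    negasymEdgeCount≡residues = trans (count-along-circuit isNegasym) (countIn-cong (upTo p)
      (λ {j} _ negasym → does-complete ((j + j) % p ℕ.≟ c % p)
        (Equivalence.to (rotN-negasym⇔ j) (does-sound (rotN j u ≟T _) negasym)))
      (λ {j} _ 2j≡c → does-complete (rotN j u ≟T _)
        (Equivalence.from (rotN-negasym⇔ j) (does-sound ((j + j) % p ℕ.≟ c % p) 2j≡c))))

    rotNegasymEdgeCount≡residues : countOn u isRotNegasym ≡ residues twice+1 (c % p)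
    rotNegasymEdgeCount≡residues = trans (count-along-circuit isRotNegasym) (countIn-cong (upTo p)
      (λ {j} _ rotNegasym → does-complete (suc (j + j) % p ℕ.≟ c % p)
        (Equivalence.to (rotN-rotNegasym⇔ j) (does-sound (rot (rotN j u) ≟T _) rotNegasym)))
      (λ {j} _ 2j+1≡c → does-complete (rot (rotN j u) ≟T _)
        (Equivalence.from (rotN-rotNegasym⇔ j) (does-sound (suc (j + j) % p ℕ.≟ c % p) 2j+1≡c))))

    negasym+rotNegasym-edges : negasymEdgeCount u + countOn u isRotNegasym ≡ 2
    negasym+rotNegasym-edges = trans (cong₂ _+_ negasymEdgeCount≡residues rotNegasymEdgeCount≡residues)
      (residues-twice-total (c % p) (m%n<n c p))

    one-negasym-edge⇒odd-period : negasymEdgeCount u ≡ 1 → ¬ (2 ∣ p)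
    one-negasym-edge⇒odd-period one 2∣p = let (q , p≡2q) = ∣2⇒double p 2∣p in
      residues-twice-even-period q p≡2q (c % p) (m%n<n c p) (trans (sym negasymEdgeCount≡residues) one)

    period-∣-odd-part : (t m : ℕ) → suc n′ ≡ 2 ^ t * m → ¬ (2 ∣ p) → p ∣ m
    period-∣-odd-part t m n≡2^t*m 2∤p = odd-∣-2^t*m t m 2∤p (subst (p ∣_) n≡2^t*m (period-∣ (suc n′) (rotN-length u)))

    rotN-fixed-by-period-multiple : (m : ℕ) → p ∣ m → rotN m u ≡ u
    rotN-fixed-by-period-multiple m (divides q refl) = rotN-*-period p u rotN-period q

  negasym-fixed-by-odd⇒one-negasym-edge : {k n′ : ℕ} (u : Tuple (suc k) (suc n′)) (m : ℕ) → ¬ (2 ∣ m) →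
    u ≡ negRev u → rotN m u ≡ u → negasymEdgeCount u ≡ 1
  negasym-fixed-by-odd⇒one-negasym-edge u m 2∤m u≡negRev-u rotN-m-u≡u =
    trans negasymEdgeCount≡residues (residues-twice-odd-period (proj₁ odd-period) (proj₂ odd-period))
    where
    open NegasymmetricCircuit u 0 (sym u≡negRev-u)
    open HalvingModulo p-1 using (residues-twice-odd-period)
    odd-period : ∃[ q ] p ≡ suc (q + q)
    odd-period = ∤2⇒odd p (λ 2∣p → 2∤m (∣-trans 2∣p (period-∣ m rotN-m-u≡u)))

  -- Negasymmetric tuples

  module NegasymmetricTuples {k : ℕ} where

    open Negation {k}
    open NegatedReversal {k}
    private
      K = suc k

    isNegasym⇒ : {n : ℕ} (v : Tuple K n) → T (isNegasym v) → v ≡ negRev v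
    isNegasym⇒ v = does-sound (v ≟T negRev v)

    ⇒isNegasym : {n : ℕ} (v : Tuple K n) → v ≡ negRev v → T (isNegasym v)
    ⇒isNegasym v = does-complete (v ≟T negRev v)

    count-negasym-even : (h : ℕ) → count {K} {h + h} isNegasym ≡ K ^ h
    count-negasym-even h = trans (sym (count-bijection mirror mirror-negasym mirror-injective mirror-onto)) (count-true K h)
      where
      mirror : Tuple K h → Tuple K (h + h)
      mirror w = w ++ negRev w
      mirror-negasym : ∀ w → T true → T (isNegasym (mirror w))
      mirror-negasym w _ = ⇒isNegasym (mirror w) (sym (trans (negRev-++ w (negRev w)) (cong (_++ negRev w) (negRev-involutive w))))
      mirror-injective : ∀ {x y} → T true → T true → mirror x ≡ mirror y → x ≡ y
      mirror-injective {x} {y} _ _ = Vecₚ.++-injectiveˡ x y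
      mirror-onto : ∀ v → T (isNegasym v) → ∃[ w ] T true × mirror w ≡ v
      mirror-onto v negasym with x , y , refl ← splitAt h v
        with x≡ , y≡ ← Vecₚ.++-injective x (negRev y) (trans (isNegasym⇒ (x ++ y) negasym) (negRev-++ x y)) =
        x , tt , cong (x ++_) (trans (cong negRev x≡) (negRev-involutive y))

    count-negasym-odd : (h : ℕ) → count {K} {h + suc h} isNegasym ≡ δ K * K ^ h
    count-negasym-odd h = begin
      count {K} {h + suc h} isNegasym                      ≡⟨ sym (count-bijection mirror mirror-negasym mirror-injective mirror-onto) ⟩
      count {K} {suc h} (λ v → isFixed (head v) ∧ true)    ≡⟨ count-head-tail {K} {h} isFixed (λ _ → true) ⟩
      countIn isFixed (allFin K) * count {K} {h} (λ _ → true) ≡⟨ cong₂ _*_ count-fixed (count-true K h) ⟩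
      δ K * K ^ h                                          ∎
      where
      open ≡-Reasoning
      mirror : Tuple K (suc h) → Tuple K (h + suc h)
      mirror (a ∷ w) = w ++ (a ∷ negRev w)
      mirror-negasym : ∀ v → T (isFixed (head v) ∧ true) → T (isNegasym (mirror v))
      mirror-negasym (a ∷ w) fixed = ⇒isNegasym (mirror (a ∷ w)) (sym (trans (negRev-++-∷ w a (negRev w))
        (cong₂ (λ x b → x ++ (b ∷ negRev w)) (negRev-involutive w) (does-sound (negF a Finₚ.≟ a) (proj₁ (∧-elim fixed))))))
      mirror-injective : ∀ {x y} → T (isFixed (head x) ∧ true) → T (isFixed (head y) ∧ true) → mirror x ≡ mirror y → x ≡ y
      mirror-injective {a ∷ w} {b ∷ z} _ _ eq with refl , a∷≡b∷ ← Vecₚ.++-injective w z eq = cong (_∷ w) (Vecₚ.∷-injectiveˡ a∷≡b∷)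
      mirror-onto : ∀ v → T (isNegasym v) → ∃[ w ] T (isFixed (head w) ∧ true) × mirror w ≡ v
      mirror-onto v negasym with x , b ∷ y , refl ← splitAt h v
        with x≡ , b∷y≡ ← Vecₚ.++-injective x (negRev y) (trans (isNegasym⇒ (x ++ (b ∷ y)) negasym) (negRev-++-∷ x b y)) =
        b ∷ x , ∧-intro (does-complete (negF b Finₚ.≟ b) (sym (Vecₚ.∷-injectiveˡ b∷y≡))) tt ,
        cong (λ z → x ++ (b ∷ z)) (trans (cong negRev x≡) (negRev-involutive y))

    count-rotNegasym : (n : ℕ) → count {K} {suc n} isRotNegasym ≡ δ K * count {K} {n} isNegasym
    count-rotNegasym n = begin
      count {K} {suc n} isRotNegasym
        ≡⟨ count-cong {n = suc n} {P = isRotNegasym} {Q = λ v → isFixed (head v) ∧ isNegasym (tail v)} rotNegasym⇒ ⇒rotNegasym ⟩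
      count {K} {suc n} (λ v → isFixed (head v) ∧ isNegasym (tail v)) ≡⟨ count-head-tail {K} {n} isFixed isNegasym ⟩
      countIn isFixed (allFin K) * count {K} {n} isNegasym        ≡⟨ cong (_* count {K} {n} isNegasym) count-fixed ⟩
      δ K * count {K} {n} isNegasym                               ∎
      where
      open ≡-Reasoning
      rotNegasym⇒ : ∀ v → T (isRotNegasym v) → T (isFixed (head v) ∧ isNegasym (tail v))
      rotNegasym⇒ (a ∷ w) rotNegasym
        with w≡ , a≡ ← Vecₚ.∷ʳ-injective w (negRev w) (trans (does-sound (rot (a ∷ w) ≟T _) rotNegasym) (negRev-∷ a w)) =
        ∧-intro (does-complete (negF a Finₚ.≟ a) (sym a≡)) (⇒isNegasym w w≡)
      ⇒rotNegasym : ∀ v → T (isFixed (head v) ∧ isNegasym (tail v)) → T (isRotNegasym v)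
      ⇒rotNegasym (a ∷ w) fixed∧negasym = does-complete (rot (a ∷ w) ≟T _) (trans
        (cong₂ _∷ʳ_ (isNegasym⇒ w (proj₂ (∧-elim fixed∧negasym))) (sym (does-sound (negF a Finₚ.≟ a) (proj₁ (∧-elim fixed∧negasym)))))
        (sym (negRev-∷ a w)))

    isNegasymFixedBy : {n : ℕ} → ℕ → Tuple K n → Bool
    isNegasymFixedBy m v = isNegasym v ∧ does (rotN m v ≟T v)

    count-negasymFixedBy-double : (m h : ℕ) → m ∣ h →
      count {K} {h + h} (isNegasymFixedBy m) ≡ count {K} {h} (isNegasymFixedBy m)
    count-negasymFixedBy-double m h (divides q h≡q*m) = sym (count-bijection double double-preserves double-injective double-onto)
      where
      double : Tuple K h → Tuple K (h + h)
      double w = w ++ w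
      double-preserves : ∀ w → T (isNegasymFixedBy m w) → T (isNegasymFixedBy m (double w))
      double-preserves w negasym∧fixed with negasym , fixed ← ∧-elim {isNegasym w} negasym∧fixed = ∧-intro
        (⇒isNegasym (double w) (trans (cong₂ _++_ w≡ w≡) (sym (negRev-++ w w))))
        (does-complete (rotN m (double w) ≟T double w) (trans (rotN-++-self m w) (cong₂ _++_ rotN-m-w≡w rotN-m-w≡w)))
        where
        w≡ : w ≡ negRev w
        w≡ = isNegasym⇒ w negasym
        rotN-m-w≡w : rotN m w ≡ w
        rotN-m-w≡w = does-sound (rotN m w ≟T w) fixed
      double-injective : ∀ {x y} → T (isNegasymFixedBy m x) → T (isNegasymFixedBy m y) → double x ≡ double y → x ≡ y
      double-injective {x} {y} _ _ = Vecₚ.++-injectiveˡ x y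
      double-onto : ∀ v → T (isNegasymFixedBy m v) → ∃[ w ] T (isNegasymFixedBy m w) × double w ≡ v
      double-onto v negasym∧fixed with x , y , refl ← splitAt h v
        with negasym , fixed ← ∧-elim {isNegasym (x ++ y)} negasym∧fixed
        with refl ← rotN-fixed⇒halves-equal m (divides q h≡q*m) x y (does-sound (rotN m (x ++ y) ≟T (x ++ y)) fixed) = x , ∧-intro
          (⇒isNegasym x (Vecₚ.++-injectiveˡ x (negRev x) (trans (isNegasym⇒ (x ++ x) negasym) (negRev-++ x x))))
          (does-complete (rotN m x ≟T x) (Vecₚ.++-injectiveˡ (rotN m x) x
            (trans (sym (rotN-++-self m x)) (does-sound (rotN m (x ++ x) ≟T (x ++ x)) fixed)))) ,
          refl

    count-negasymFixedBy-odd-part : (t m : ℕ) → count {K} {2 ^ t * m} (isNegasymFixedBy m) ≡ count {K} {m} isNegasym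
    count-negasymFixedBy-odd-part zero m = begin
      count {K} {2 ^ 0 * m} (isNegasymFixedBy m)  ≡⟨ cong (λ n → count {K} {n} (isNegasymFixedBy m)) (+-identityʳ m) ⟩
      count {K} {m} (isNegasymFixedBy m)          ≡⟨ count-cong {n = m} {P = isNegasymFixedBy m} {Q = isNegasym} (λ _ → proj₁ ∘ ∧-elim)
                                                       (λ v negasym → ∧-intro negasym (does-complete (rotN m v ≟T v) (rotN-length v))) ⟩
      count {K} {m} isNegasym                     ∎
      where open ≡-Reasoning
    count-negasymFixedBy-odd-part (suc t) m = begin
      count {K} {2 ^ suc t * m} (isNegasymFixedBy m)  ≡⟨ cong (λ n → count {K} {n} (isNegasymFixedBy m)) 2^[1+t]m≡ ⟩
      count {K} {2 ^ t * m + 2 ^ t * m} (isNegasymFixedBy m) ≡⟨ count-negasymFixedBy-double m (2 ^ t * m) (n∣m*n (2 ^ t)) ⟩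
      count {K} {2 ^ t * m} (isNegasymFixedBy m)      ≡⟨ count-negasymFixedBy-odd-part t m ⟩
      count {K} {m} isNegasym                         ∎
      where
      open ≡-Reasoning
      2^[1+t]m≡ : 2 ^ suc t * m ≡ 2 ^ t * m + 2 ^ t * m
      2^[1+t]m≡ = trans (*-assoc 2 (2 ^ t) m) (cong (2 ^ t * m +_) (+-identityʳ (2 ^ t * m)))

  -- Admissible edge sets

  module Pseudoweight {k n′ : ℕ} where

    open NegatedReversal {k}
    open Circuit {suc k} {n′}

    private
      K = suc k
      n = suc n′

    Tup : Set
    Tup = Tuple K n

    -- isLight v: v ∈ E_k(n-1); isBalanced v: v is an edge of H_k(n-1).
    isLight isBalanced isHeavy isNegasymCircuit : Tup → Bool
    isLight v = does (pw2T v ℕ.<? K * n)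
    isBalanced v = does (pw2T v ℕ.≟ K * n)
    isHeavy v = does (K * n ℕ.<? pw2T v)
    isNegasymCircuit v = inCircuit v (negRev v)

    pw2T-negRev-sum : (v : Tup) → pw2T (negRev v) + pw2T v ≡ K * n + K * n
    pw2T-negRev-sum v = trans (pw2T-negRev v) (begin
      n * (2 * K)          ≡⟨ cong (n *_) (cong (K +_) (+-identityʳ K)) ⟩
      n * (K + K)          ≡⟨ *-distribˡ-+ n K K ⟩
      n * K + n * K        ≡⟨ cong₂ _+_ (*-comm n K) (*-comm n K) ⟩
      K * n + K * n        ∎)
      where open ≡-Reasoning

    negRev-balanced : (v : Tup) → T (isBalanced v) → T (isBalanced (negRev v))
    negRev-balanced v balanced = does-complete (pw2T (negRev v) ℕ.≟ K * n) (+-cancelʳ-≡ (pw2T v) _ _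
      (trans (pw2T-negRev-sum v) (cong (K * n +_) (sym (does-sound (pw2T v ℕ.≟ K * n) balanced)))))

    negRev-balanced⁻ : (v : Tup) → T (isBalanced (negRev v)) → T (isBalanced v)
    negRev-balanced⁻ v balanced = subst (T ∘ isBalanced) (negRev-involutive v) (negRev-balanced (negRev v) balanced)

    count-∘negRev : (Q : Tup → Bool) → count (Q ∘ negRev) ≡ count Q
    count-∘negRev Q = count-bijection negRev (λ _ → λ q → q) (λ _ _ → negRev-injective)
      (λ v qv → negRev v , subst (T ∘ Q) (sym (negRev-involutive v)) qv , negRev-involutive v)

    count-light≡count-heavy : count isLight ≡ count isHeavy
    count-light≡count-heavy = trans (sym (count-∘negRev isLight)) (count-cong {P = isLight ∘ negRev} {Q = isHeavy}
      (λ v light → does-complete (K * n ℕ.<? pw2T v) (heavy-partner (pw2T v) (pw2T (negRev v))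
        (trans (+-comm (pw2T v) _) (pw2T-negRev-sum v)) (does-sound (pw2T (negRev v) ℕ.<? K * n) light)))
      (λ v heavy → does-complete (pw2T (negRev v) ℕ.<? K * n) (light-partner (pw2T (negRev v)) (pw2T v)
        (pw2T-negRev-sum v) (does-sound (K * n ℕ.<? pw2T v) heavy))))
      where
      heavy-partner : ∀ a b → a + b ≡ K * n + K * n → b < K * n → K * n < a
      heavy-partner a b a+b≡ b< = ≰⇒> λ a≤ → <⇒≢ (+-mono-≤-< a≤ b<) a+b≡
      light-partner : ∀ a b → a + b ≡ K * n + K * n → K * n < b → a < K * n
      light-partner a b a+b≡ <b = ≰⇒> λ ≤a → <⇒≢ (+-mono-≤-< ≤a <b) (sym a+b≡)

    k^n≡light+light+balanced : K ^ n ≡ count isLight + count isLight + count isBalanced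
    k^n≡light+light+balanced = begin
      K ^ n                                                      ≡⟨ sym (count-true K n) ⟩
      count {K} {n} (λ _ → true)                                 ≡⟨ countIn-split (λ _ → true) isLight (allTuples K n) ⟩
      count isLight + count (not ∘ isLight)                      ≡⟨ cong (count isLight +_) (countIn-split (not ∘ isLight) isBalanced (allTuples K n)) ⟩
      count isLight + (count (λ v → not (isLight v) ∧ isBalanced v) + count (λ v → not (isLight v) ∧ not (isBalanced v)))
        ≡⟨ cong (count isLight +_) (cong₂ _+_
             (count-cong (λ _ → proj₂ ∘ ∧-elim) balanced⇒not-light)
             (trans (count-cong not-light∧not-balanced⇒heavy heavy⇒not-light∧not-balanced) (sym count-light≡count-heavy))) ⟩
      count isLight + (count isBalanced + count isLight)
        ≡⟨ +-*-Solver.solve 2 (λ l b → l :+ (b :+ l) := (l :+ l) :+ b) refl (count isLight) (count isBalanced) ⟩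
      count isLight + count isLight + count isBalanced           ∎
      where
      open ≡-Reasoning
      balanced⇒not-light : ∀ v → T (isBalanced v) → T (not (isLight v) ∧ isBalanced v)
      balanced⇒not-light v balanced = ∧-intro
        (does-complete (¬? (pw2T v ℕ.<? K * n)) (<-irrefl (does-sound (pw2T v ℕ.≟ K * n) balanced))) balanced
      not-light∧not-balanced⇒heavy : ∀ v → T (not (isLight v) ∧ not (isBalanced v)) → T (isHeavy v)
      not-light∧not-balanced⇒heavy v neither with ¬light , ¬balanced ← ∧-elim {not (isLight v)} neither =
        does-complete (K * n ℕ.<? pw2T v) (case <-cmp (pw2T v) (K * n) of λ where
          (tri< light _ _) → ⊥-elim (does-sound (¬? (pw2T v ℕ.<? K * n)) ¬light light)
          (tri≈ _ balanced _) → ⊥-elim (does-sound (¬? (pw2T v ℕ.≟ K * n)) ¬balanced balanced)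
          (tri> _ _ heavy) → heavy)
      heavy⇒not-light∧not-balanced : ∀ v → T (isHeavy v) → T (not (isLight v) ∧ not (isBalanced v))
      heavy⇒not-light∧not-balanced v heavy = ∧-intro
        (does-complete (¬? (pw2T v ℕ.<? K * n)) (<-asym (does-sound (K * n ℕ.<? pw2T v) heavy)))
        (does-complete (¬? (pw2T v ℕ.≟ K * n)) (>⇒≢ (does-sound (K * n ℕ.<? pw2T v) heavy)))

    NegasymCircuit⇒ : (v : Tup) → NegasymCircuit v → T (isNegasymCircuit v)
    NegasymCircuit⇒ v (a , b , v~a , v~b , a≡) with i , refl ← inCircuit⇒ v a v~a | j , refl ← inCircuit⇒ v b v~b =
      ⇒inCircuit v (negRev v) (i + j) (begin
        rotN (i + j) v                   ≡⟨ rotN-+ i j v ⟩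
        rotN j (rotN i v)                ≡⟨ cong (rotN j) a≡ ⟩
        rotN j (negRev (rotN j v))       ≡⟨ rotN-negRev-rotN j v ⟩
        negRev v                         ∎)
      where open ≡-Reasoning

    ⇒NegasymCircuit : (v : Tup) → T (isNegasymCircuit v) → NegasymCircuit v
    ⇒NegasymCircuit v v~negRev-v = negRev v , v , v~negRev-v , inCircuit-refl v , refl

    negRev-negasymCircuit : (v : Tup) → T (isNegasymCircuit v) → T (isNegasymCircuit (negRev v))
    negRev-negasymCircuit v v~negRev-v =
      subst (T ∘ inCircuit (negRev v)) (sym (negRev-involutive v)) (inCircuit-sym v (negRev v) v~negRev-v)

    negRev-negasymCircuit⁻ : (v : Tup) → T (isNegasymCircuit (negRev v)) → T (isNegasymCircuit v)
    negRev-negasymCircuit⁻ v = subst (T ∘ isNegasymCircuit) (negRev-involutive v) ∘ negRev-negasymCircuit (negRev v)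

    isBalancedNegasym isPaired : Tup → Bool
    isBalancedNegasym v = isBalanced v ∧ isNegasymCircuit v
    isPaired v = isBalanced v ∧ not (isNegasymCircuit v)

    count-balanced-split : count isBalanced ≡ count isBalancedNegasym + count isPaired
    count-balanced-split = countIn-split isBalanced isNegasymCircuit (allTuples K n)

    count-balancedNegasym≤count-balanced : count isBalancedNegasym ≤ count isBalanced
    count-balancedNegasym≤count-balanced = subst (count isBalancedNegasym ≤_) (sym count-balanced-split) (m≤m+n _ _)

    module Admissible (X : Tup → Bool) (X-admissible : IsX X) where

      sel : Tup → Bool
      sel = proj₁ X-admissible

      sel-invariant : ∀ u v → T (inCircuit u v) → sel u ≡ sel v
      sel-invariant = proj₁ (proj₂ X-admissible)

      sel-one-of-pair : ∀ u → InC u → ¬ NegasymCircuit u →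
        (T (sel u) × ¬ T (sel (negRev u))) ⊎ (¬ T (sel u) × T (sel (negRev u)))
      sel-one-of-pair = proj₁ (proj₂ (proj₂ (proj₂ X-admissible)))

      X-edges : ∀ v → (T (X v) → (pw2T v < K * n) ⊎ (∃[ u ] (T (sel u) × T (inCircuit u v)))) ×
                      ((pw2T v < K * n) ⊎ (∃[ u ] (T (sel u) × T (inCircuit u v))) → T (X v))
      X-edges = proj₂ (proj₂ (proj₂ (proj₂ X-admissible)))

      light⇒X : ∀ v → T (isLight v) → T (X v)
      light⇒X v light = proj₂ (X-edges v) (inj₁ (does-sound (pw2T v ℕ.<? K * n) light))

      selected⇒X : ∀ v → T (sel v) → T (X v)
      selected⇒X v selected = proj₂ (X-edges v) (inj₂ (v , selected , inCircuit-refl v))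

      balanced∧X⇒selected : ∀ v → T (isBalanced v) → T (X v) → T (sel v)
      balanced∧X⇒selected v balanced Xv with proj₁ (X-edges v) Xv
      ... | inj₁ light = ⊥-elim (<-irrefl (does-sound (pw2T v ℕ.≟ K * n) balanced) light)
      ... | inj₂ (u , selected , u~v) = subst T (sel-invariant u v u~v) selected

      X-xor-negRev : ∀ v → T (isBalanced v) → ¬ T (isNegasymCircuit v) → T (X v) ⇔ (¬ T (X (negRev v)))
      X-xor-negRev v balanced ¬negasym with sel-one-of-pair v (does-sound (pw2T v ℕ.≟ K * n) balanced) (¬negasym ∘ NegasymCircuit⇒ v)
      ... | inj₁ (sel-v , ¬sel-negRev-v) = mk⇔
        (λ _ X-negRev-v → ¬sel-negRev-v (balanced∧X⇒selected (negRev v) (negRev-balanced v balanced) X-negRev-v))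
        (λ _ → selected⇒X v sel-v)
      ... | inj₂ (¬sel-v , sel-negRev-v) = mk⇔
        (λ Xv → ⊥-elim (¬sel-v (balanced∧X⇒selected v balanced Xv)))
        (λ ¬X-negRev-v → ⊥-elim (¬X-negRev-v (selected⇒X (negRev v) sel-negRev-v)))

      paired-in-X paired-outside-X : Tup → Bool
      paired-in-X v = isPaired v ∧ X v
      paired-outside-X v = isPaired v ∧ not (X v)

      count-paired-in-X≡outside : count paired-in-X ≡ count paired-outside-X
      count-paired-in-X≡outside = trans (sym (count-∘negRev paired-in-X)) (count-cong {P = paired-in-X ∘ negRev} {Q = paired-outside-X}
        (λ v in-X → let (paired , X-negRev-v) = ∧-elim {isPaired (negRev v)} in-X
                        (balanced , ¬negasym) = ∧-elim {isBalanced (negRev v)} paired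
                        balanced-v = negRev-balanced⁻ v balanced
                        ¬negasym-v = not-elim ¬negasym ∘ negRev-negasymCircuit v in
                    ∧-intro (∧-intro balanced-v (not-intro ¬negasym-v))
                            (not-intro λ Xv → Equivalence.to (X-xor-negRev v balanced-v ¬negasym-v) Xv X-negRev-v))
        (λ v outside-X → let (paired , ¬Xv) = ∧-elim {isPaired v} outside-X
                             (balanced , ¬negasym) = ∧-elim {isBalanced v} paired in
                         ∧-intro (∧-intro (negRev-balanced v balanced) (not-intro (not-elim ¬negasym ∘ negRev-negasymCircuit⁻ v)))
                                 (decidable-stable (T? _) λ ¬X-negRev-v →
                                   not-elim ¬Xv (Equivalence.from (X-xor-negRev v balanced (not-elim ¬negasym)) ¬X-negRev-v))))

      count-paired≡2*in-X : count isPaired ≡ count paired-in-X + count paired-in-X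
      count-paired≡2*in-X = trans (countIn-split isPaired X (allTuples K n)) (cong (count paired-in-X +_) (sym count-paired-in-X≡outside))

      light+paired-in-X≤X : count isLight + count paired-in-X ≤ count X
      light+paired-in-X≤X = begin
        count isLight + count paired-in-X                          ≤⟨ +-mono-≤ (count-mono light⇒X∧light) (count-mono paired-in-X⇒X∧heavy) ⟩
        count (λ v → X v ∧ isLight v) + count (λ v → X v ∧ not (isLight v)) ≡⟨ sym (countIn-split X isLight (allTuples K n)) ⟩
        count X                                                    ∎
        where
        open ≤-Reasoning
        light⇒X∧light : ∀ v → T (isLight v) → T (X v ∧ isLight v)
        light⇒X∧light v light = ∧-intro (light⇒X v light) light
        paired-in-X⇒X∧heavy : ∀ v → T (paired-in-X v) → T (X v ∧ not (isLight v))
        paired-in-X⇒X∧heavy v in-X with paired , Xv ← ∧-elim {isPaired v} in-X = ∧-intro Xv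
          (does-complete (¬? (pw2T v ℕ.<? K * n)) (<-irrefl (does-sound (pw2T v ℕ.≟ K * n) (proj₁ (∧-elim {isBalanced v} paired)))))

      k^n≤2X+balancedNegasym : K ^ n ≤ count X + count X + count isBalancedNegasym
      k^n≤2X+balancedNegasym = begin
        K ^ n                                                ≡⟨ k^n≡light+light+balanced ⟩
        count isLight + count isLight + count isBalanced
          ≡⟨ cong (count isLight + count isLight +_) (trans count-balanced-split (cong (S +_) count-paired≡2*in-X)) ⟩
        count isLight + count isLight + (S + (D + D))
          ≡⟨ +-*-Solver.solve 3 (λ l s d → l :+ l :+ (s :+ (d :+ d)) := (l :+ d) :+ (l :+ d) :+ s) refl (count isLight) S D ⟩
        (count isLight + D) + (count isLight + D) + S        ≤⟨ +-monoˡ-≤ S (+-mono-≤ light+paired-in-X≤X light+paired-in-X≤X) ⟩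
        count X + count X + S                                ∎
        where
        open ≤-Reasoning
        S D : ℕ
        S = count isBalancedNegasym
        D = count paired-in-X

  -- The classes N₀, N₁, N₂ and the closed forms

  module Classes {k n′ : ℕ} where

    open NegatedReversal {k}
    open Pseudoweight {k} {n′}
    open Circuit {suc k} {n′}

    private
      K = suc k
      n = suc n′

    hasNegasymEdges : ℕ → Tup → Bool
    hasNegasymEdges i v = does (negasymEdgeCount v ℕ.≟ i)

    negasym+rotNegasym-edges≡2 : (u : Tup) → T (isNegasymCircuit u) →
      negasymEdgeCount u + countOn u isRotNegasym ≡ 2
    negasym+rotNegasym-edges≡2 u u~negRev-u with c , rotN-c-u≡ ← inCircuit⇒ u (negRev u) u~negRev-u =
      NegasymmetricCircuit.negasym+rotNegasym-edges u c (sym rotN-c-u≡)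

    negasymEdgeCount≤2 : (u : Tup) → T (isNegasymCircuit u) → negasymEdgeCount u ≤ 2
    negasymEdgeCount≤2 u negasym = subst (negasymEdgeCount u ≤_) (negasym+rotNegasym-edges≡2 u negasym) (m≤m+n _ _)

    onCircuits : {N : ℕ} → (Fin N → Tup) → (Tup → Bool) → ℕ
    onCircuits {N} L P = ∑[ j < N ] countOn (L j) P

    NegasymBalanced : (Tup → Bool) → Set
    NegasymBalanced P = ∀ v → T (P v) → T (isBalanced v) × T (isNegasymCircuit v)

    module Class (i N : ℕ) (C : CircuitCount (InN i {K} {n}) N) where

      L : Fin N → Tup
      L = proj₁ C

      L-in-class : ∀ j → InN i (L j)
      L-in-class = proj₁ (proj₂ C)

      L-distinct : ∀ a b → T (inCircuit (L a) (L b)) → a ≡ b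
      L-distinct = proj₁ (proj₂ (proj₂ C))

      L-covers : ∀ u → InN i u → ∃[ j ] T (inCircuit (L j) u)
      L-covers = proj₂ (proj₂ (proj₂ C))

      L-negasym : ∀ j → T (isNegasymCircuit (L j))
      L-negasym j = NegasymCircuit⇒ (L j) (proj₁ (proj₂ (L-in-class j)))

      on-L-in-class : ∀ j v → T (inCircuit (L j) v) → negasymEdgeCount v ≡ i
      on-L-in-class j v on-L = trans (sym (countOn-invariant (L j) v isNegasym on-L)) (proj₂ (proj₂ (L-in-class j)))

      count-in-class : (P : Tup → Bool) → NegasymBalanced P → count (λ v → P v ∧ hasNegasymEdges i v) ≡ onCircuits L P
      count-in-class P P-negasym = trans
        (countIn-partition (λ j v → inCircuit (L j) v) _ (allTuples K n) covered disjoint)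
        (sum-cong-≗ λ j → countOn-cong (L j) (λ v _ → proj₁ ∘ ∧-elim {P v})
          (λ v L~v Pv → ∧-intro Pv (does-complete (negasymEdgeCount v ℕ.≟ i) (on-L-in-class j v L~v))))
        where
        covered : ∀ v → T (P v ∧ hasNegasymEdges i v) → ∃[ j ] T (inCircuit (L j) v)
        covered v P∧i = let (Pv , has-i) = ∧-elim {P v} P∧i ; (balanced , negasym) = P-negasym v Pv in
          L-covers v (does-sound (pw2T v ℕ.≟ K * n) balanced , ⇒NegasymCircuit v negasym , does-sound (negasymEdgeCount v ℕ.≟ i) has-i)
        disjoint : ∀ v {a b} → T (P v ∧ hasNegasymEdges i v) → T (inCircuit (L a) v) → T (inCircuit (L b) v) → a ≡ b
        disjoint v {a} {b} _ La~v Lb~v = L-distinct a b (inCircuit-trans (L a) v (L b) La~v (inCircuit-sym (L b) v Lb~v))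

    onCircuits-none : {N : ℕ} (L : Fin N → Tup) (P : Tup → Bool) → (∀ j v → T (inCircuit (L j) v) → ¬ T (P v)) → onCircuits L P ≡ 0
    onCircuits-none {N} L P none = trans (sum-cong-≗ λ j → countIn-none (λ v on-L∧P →
      let (L~v , Pv) = ∧-elim {inCircuit (L j) v} on-L∧P in none j v L~v Pv) (allTuples K n)) (trans (sum-const N 0) (*-zeroʳ N))

    module AllClasses (N₀ N₁ N₂ : ℕ) (C₀ : CircuitCount (InN 0 {K} {n}) N₀)
                      (C₁ : CircuitCount (InN 1 {K} {n}) N₁) (C₂ : CircuitCount (InN 2 {K} {n}) N₂) where

      module C₀ = Class 0 N₀ C₀
      module C₁ = Class 1 N₁ C₁
      module C₂ = Class 2 N₂ C₂

      onClasses : (Tup → Bool) → ℕ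
      onClasses P = onCircuits C₀.L P + onCircuits C₁.L P + onCircuits C₂.L P

      count-by-classes : (P : Tup → Bool) → NegasymBalanced P → count P ≡ onClasses P
      count-by-classes P P-negasym = begin
        count P
          ≡⟨ countIn-split P (hasNegasymEdges 0) (allTuples K n) ⟩
        count (λ v → P v ∧ hasNegasymEdges 0 v) + count (λ v → P v ∧ not (hasNegasymEdges 0 v))
          ≡⟨ cong (count (λ v → P v ∧ hasNegasymEdges 0 v) +_) (countIn-split _ (hasNegasymEdges 1) (allTuples K n)) ⟩
        count (λ v → P v ∧ hasNegasymEdges 0 v) + (count (λ v → (P v ∧ not (hasNegasymEdges 0 v)) ∧ hasNegasymEdges 1 v)
                                                  + count (λ v → (P v ∧ not (hasNegasymEdges 0 v)) ∧ not (hasNegasymEdges 1 v)))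
          ≡⟨ cong (count (λ v → P v ∧ hasNegasymEdges 0 v) +_) (cong₂ _+_ (count-cong drop-¬0 add-¬0) (count-cong two add-¬0¬1)) ⟩
        count (λ v → P v ∧ hasNegasymEdges 0 v) + (count (λ v → P v ∧ hasNegasymEdges 1 v) + count (λ v → P v ∧ hasNegasymEdges 2 v))
          ≡⟨ cong₂ _+_ (C₀.count-in-class P P-negasym) (cong₂ _+_ (C₁.count-in-class P P-negasym) (C₂.count-in-class P P-negasym)) ⟩
        onCircuits C₀.L P + (onCircuits C₁.L P + onCircuits C₂.L P)
          ≡⟨ sym (+-assoc (onCircuits C₀.L P) _ _) ⟩
        onClasses P
          ∎
        where
        open ≡-Reasoning
        has : ∀ i v → T (hasNegasymEdges i v) → negasymEdgeCount v ≡ i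
        has i v = does-sound (negasymEdgeCount v ℕ.≟ i)
        drop-¬0 : ∀ v → T ((P v ∧ not (hasNegasymEdges 0 v)) ∧ hasNegasymEdges 1 v) → T (P v ∧ hasNegasymEdges 1 v)
        drop-¬0 v P¬0∧1 = let (P¬0 , one) = ∧-elim {P v ∧ _} P¬0∧1 in ∧-intro (proj₁ (∧-elim {P v} P¬0)) one
        add-¬0 : ∀ v → T (P v ∧ hasNegasymEdges 1 v) → T ((P v ∧ not (hasNegasymEdges 0 v)) ∧ hasNegasymEdges 1 v)
        add-¬0 v P∧1 = let (Pv , one) = ∧-elim {P v} P∧1 in
          ∧-intro (∧-intro Pv (does-complete (¬? (negasymEdgeCount v ℕ.≟ 0)) λ zero → 0≢1+n (trans (sym zero) (has 1 v one)))) one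
        two : ∀ v → T ((P v ∧ not (hasNegasymEdges 0 v)) ∧ not (hasNegasymEdges 1 v)) → T (P v ∧ hasNegasymEdges 2 v)
        two v P¬0¬1 with P¬0 , ¬1 ← ∧-elim {P v ∧ _} P¬0¬1 with Pv , ¬0 ← ∧-elim {P v} P¬0 =
          ∧-intro Pv (does-complete (negasymEdgeCount v ℕ.≟ 2)
            (≤-antisym (negasymEdgeCount≤2 v (proj₂ (P-negasym v Pv)))
                       (≰⇒> λ ≤1 → case m≤n⇒m<n∨m≡n ≤1 of λ where
                          (inj₁ <1) → does-sound (¬? (negasymEdgeCount v ℕ.≟ 0)) ¬0 (n<1⇒n≡0 <1)
                          (inj₂ ≡1) → does-sound (¬? (negasymEdgeCount v ℕ.≟ 1)) ¬1 ≡1)))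
        add-¬0¬1 : ∀ v → T (P v ∧ hasNegasymEdges 2 v) → T ((P v ∧ not (hasNegasymEdges 0 v)) ∧ not (hasNegasymEdges 1 v))
        add-¬0¬1 v P∧2 = let (Pv , two) = ∧-elim {P v} P∧2 in ∧-intro
          (∧-intro Pv (does-complete (¬? (negasymEdgeCount v ℕ.≟ 0)) λ zero → 0≢1+n (trans (sym zero) (has 2 v two))))
          (does-complete (¬? (negasymEdgeCount v ℕ.≟ 1)) λ one → 1+n≢n (trans (sym (has 2 v two)) one))

      negasym-balanced : NegasymBalanced isNegasym
      negasym-balanced v negasym = does-complete (pw2T v ℕ.≟ K * n) (m+m≡n+n⇒m≡n _ _ (begin
        pw2T v + pw2T v             ≡⟨ cong (_+ pw2T v) (cong pw2T v≡) ⟩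
        pw2T (negRev v) + pw2T v    ≡⟨ pw2T-negRev-sum v ⟩
        K * n + K * n               ∎)) , ⇒inCircuit v (negRev v) 0 v≡
        where
        open ≡-Reasoning
        v≡ : v ≡ negRev v
        v≡ = does-sound (v ≟T negRev v) negasym

      rotNegasym-balanced : NegasymBalanced isRotNegasym
      rotNegasym-balanced v rotNegasym = does-complete (pw2T v ℕ.≟ K * n) (m+m≡n+n⇒m≡n _ _ (begin
        pw2T v + pw2T v             ≡⟨ cong (_+ pw2T v) (sym (pw2T-rotN 1 v)) ⟩
        pw2T (rot v) + pw2T v       ≡⟨ cong (_+ pw2T v) (cong pw2T rot-v≡) ⟩
        pw2T (negRev v) + pw2T v    ≡⟨ pw2T-negRev-sum v ⟩
        K * n + K * n               ∎)) , ⇒inCircuit v (negRev v) 1 rot-v≡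
        where
        open ≡-Reasoning
        rot-v≡ : rot v ≡ negRev v
        rot-v≡ = does-sound (rot v ≟T negRev v) rotNegasym

      count-negasym+rotNegasym : count {K} {n} isNegasym + count {K} {n} isRotNegasym ≡ (N₀ + N₁ + N₂) * 2
      count-negasym+rotNegasym = begin
        count {K} {n} isNegasym + count {K} {n} isRotNegasym
          ≡⟨ cong₂ _+_ (count-by-classes isNegasym negasym-balanced) (count-by-classes isRotNegasym rotNegasym-balanced) ⟩
        onClasses isNegasym + onClasses isRotNegasym
          ≡⟨ +-*-Solver.solve 6 (λ a b c x y z → (a :+ b :+ c) :+ (x :+ y :+ z) := (a :+ x) :+ (b :+ y) :+ (c :+ z)) refl
               (onCircuits C₀.L isNegasym) (onCircuits C₁.L isNegasym) (onCircuits C₂.L isNegasym)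
               (onCircuits C₀.L isRotNegasym) (onCircuits C₁.L isRotNegasym) (onCircuits C₂.L isRotNegasym) ⟩
        (onCircuits C₀.L isNegasym + onCircuits C₀.L isRotNegasym) + (onCircuits C₁.L isNegasym + onCircuits C₁.L isRotNegasym)
          + (onCircuits C₂.L isNegasym + onCircuits C₂.L isRotNegasym)
          ≡⟨ cong₂ _+_ (cong₂ _+_ (per-class C₀.L C₀.L-negasym) (per-class C₁.L C₁.L-negasym)) (per-class C₂.L C₂.L-negasym) ⟩
        N₀ * 2 + N₁ * 2 + N₂ * 2
          ≡⟨ sym (trans (*-distribʳ-+ 2 (N₀ + N₁) N₂) (cong (_+ N₂ * 2) (*-distribʳ-+ 2 N₀ N₁))) ⟩
        (N₀ + N₁ + N₂) * 2
          ∎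
        where
        open ≡-Reasoning
        per-class : {N : ℕ} (L : Fin N → Tup) → (∀ j → T (isNegasymCircuit (L j))) →
          onCircuits L isNegasym + onCircuits L isRotNegasym ≡ N * 2
        per-class {N} L L-negasym = begin
          onCircuits L isNegasym + onCircuits L isRotNegasym  ≡⟨ sym (∑-distrib-+ (λ j → negasymEdgeCount (L j)) _) ⟩
          ∑[ j < N ] (negasymEdgeCount (L j) + countOn (L j) isRotNegasym)
                                                              ≡⟨ sum-cong-≗ (λ j → negasym+rotNegasym-edges≡2 (L j) (L-negasym j)) ⟩
          ∑[ j < N ] 2                                        ≡⟨ sum-const N 2 ⟩
          N * 2                                               ∎

      module OddPart (t m : ℕ) (n≡2^t*m : n ≡ 2 ^ t * m) (m-odd : ¬ (2 ∣ m)) where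

        open NegasymmetricTuples {k} using (isNegasymFixedBy)
        open Negation {k} using (negF-zero; Half; half-of)

        one-negasym-edge⇒period-∣-m : (u : Tup) (c : ℕ) (negRev-u≡ : negRev u ≡ rotN c u) → negasymEdgeCount u ≡ 1 →
          Periodic.p u (period u) ∣ m
        one-negasym-edge⇒period-∣-m u c negRev-u≡ one = period-∣-odd-part t m n≡2^t*m (one-negasym-edge⇒odd-period one)
          where open NegasymmetricCircuit u c negRev-u≡

        one-negasym-edge⇒rotN-m-fixed : (u : Tup) → T (isNegasymCircuit u) → negasymEdgeCount u ≡ 1 → rotN m u ≡ u
        one-negasym-edge⇒rotN-m-fixed u u~negRev-u one with c , rotN-c-u≡ ← inCircuit⇒ u (negRev u) u~negRev-u =
          rotN-*-period-∣ (one-negasym-edge⇒period-∣-m u c (sym rotN-c-u≡) one)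
          where
          open Periodic u (period u) using (p; rotN-period)
          rotN-*-period-∣ : p ∣ m → rotN m u ≡ u
          rotN-*-period-∣ (divides q refl) = rotN-*-period p u rotN-period q

        one-negasym-edge⇒size≤m : (u : Tup) → T (isNegasymCircuit u) → negasymEdgeCount u ≡ 1 → count (inCircuit u) ≤ m
        one-negasym-edge⇒size≤m u u~negRev-u one with c , rotN-c-u≡ ← inCircuit⇒ u (negRev u) u~negRev-u =
          subst (_≤ m) (sym (Periodic.circuit-size u (period u)))
            (∣⇒≤ ⦃ ℕ.≢-nonZero (λ m≡0 → m-odd (divides 0 m≡0)) ⦄ (one-negasym-edge⇒period-∣-m u c (sym rotN-c-u≡) one))

        count-negasymFixedBy≡N₁ : count {K} {n} (isNegasymFixedBy m) ≡ N₁
        count-negasymFixedBy≡N₁ = begin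
          count {K} {n} (isNegasymFixedBy m)
            ≡⟨ count-by-classes (isNegasymFixedBy m) (λ v → negasym-balanced v ∘ proj₁ ∘ ∧-elim {isNegasym v}) ⟩
          onCircuits C₀.L (isNegasymFixedBy m) + onCircuits C₁.L (isNegasymFixedBy m) + onCircuits C₂.L (isNegasymFixedBy m)
            ≡⟨ cong₂ _+_ (cong₂ _+_ (onCircuits-none C₀.L _ (not-in-class C₀.on-L-in-class λ ())) (sum-cong-≗ one-per-circuit))
                         (onCircuits-none C₂.L _ (not-in-class C₂.on-L-in-class λ ())) ⟩
          0 + ∑[ j < N₁ ] 1 + 0
            ≡⟨ trans (+-identityʳ _) (trans (sum-const N₁ 1) (*-identityʳ N₁)) ⟩
          N₁
            ∎
          where
          open ≡-Reasoning
          negasymFixedBy⇒one : ∀ v → T (isNegasymFixedBy m v) → negasymEdgeCount v ≡ 1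
          negasymFixedBy⇒one v negasym∧fixed = let (negasym , fixed) = ∧-elim {isNegasym v} negasym∧fixed in
            negasym-fixed-by-odd⇒one-negasym-edge v m m-odd (does-sound (v ≟T negRev v) negasym) (does-sound (rotN m v ≟T v) fixed)
          not-in-class : ∀ {i N} {L : Fin N → Tup} → (∀ j v → T (inCircuit (L j) v) → negasymEdgeCount v ≡ i) → i ≢ 1 →
            ∀ j v → T (inCircuit (L j) v) → ¬ T (isNegasymFixedBy m v)
          not-in-class on-L-in-class i≢1 j v L~v negasym∧fixed = i≢1 (trans (sym (on-L-in-class j v L~v)) (negasymFixedBy⇒one v negasym∧fixed))
          one-per-circuit : ∀ j → countOn (C₁.L j) (isNegasymFixedBy m) ≡ 1
          one-per-circuit j = trans (countOn-cong (C₁.L j) (λ v _ → proj₁ ∘ ∧-elim {isNegasym v})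
            (λ v L~v negasym → ∧-intro negasym (does-complete (rotN m v ≟T v) (fixed v L~v))))
            (proj₂ (proj₂ (C₁.L-in-class j)))
            where
            fixed : ∀ v → T (inCircuit (C₁.L j) v) → rotN m v ≡ v
            fixed v L~v with r , refl ← inCircuit⇒ (C₁.L j) v L~v =
              trans (rotN-comm m r (C₁.L j))
                (cong (rotN r) (one-negasym-edge⇒rotN-m-fixed (C₁.L j) (C₁.L-negasym j) (proj₂ (proj₂ (C₁.L-in-class j)))))

        constant-circuit : (a : Fin K) (v : Tup) → T (inCircuit (replicate n a) v) → v ≡ replicate n a
        constant-circuit a v rep~v with j , refl ← inCircuit⇒ (replicate n a) v rep~v = rotN-replicate j a

        constants-on-one-circuit : (u : Tup) (a b : Fin K) →
          T (inCircuit u (replicate n a)) → T (inCircuit u (replicate n b)) → b ≡ a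
        constants-on-one-circuit u a b u~a u~b = cong head (constant-circuit a (replicate n b)
          (inCircuit-trans (replicate n a) u (replicate n b) (inCircuit-sym u (replicate n a) u~a) u~b))

        constant-circuit-in-N₁ : (a : Fin K) → negF a ≡ a → InN 1 (replicate n a)
        constant-circuit-in-N₁ a fixed =
          trans (pw2T-replicate n a) (trans (cong (n *_) (pw2-fixed a fixed)) (*-comm n K)) ,
          (rep , rep , inCircuit-refl rep , inCircuit-refl rep , rep≡negRev-rep) ,
          countIn-exact (allTuples-unique K n) ([] ∷ [])
            (λ { (here refl) → allTuples-complete K n rep , ∧-intro (inCircuit-refl rep) (does-complete (rep ≟T negRev rep) rep≡negRev-rep) })
            (λ {v} _ on-rep → here (constant-circuit a v (proj₁ (∧-elim {inCircuit rep v} on-rep))))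
          where
          open Negation {k} using (pw2-fixed)
          rep : Tup
          rep = replicate n a
          rep≡negRev-rep : rep ≡ negRev rep
          rep≡negRev-rep = sym (trans (negRev-replicate n a) (cong (replicate n) fixed))

        class-1-size : Fin N₁ → ℕ
        class-1-size j = countOn (C₁.L j) isBalancedNegasym

        class-1-size≤m : ∀ j → class-1-size j ≤ m
        class-1-size≤m j = ≤-trans (countOn≤size (C₁.L j) isBalancedNegasym)
          (one-negasym-edge⇒size≤m (C₁.L j) (C₁.L-negasym j) (proj₂ (proj₂ (C₁.L-in-class j))))

        constant-circuit-index : (a : Fin K) → negF a ≡ a → ∃[ j ] (class-1-size j ≤ 1 × T (inCircuit (C₁.L j) (replicate n a)))
        constant-circuit-index a fixed with j , L~rep ← C₁.L-covers (replicate n a) (constant-circuit-in-N₁ a fixed) =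
          j , countIn-≤-length {ys = replicate n a ∷ []} (allTuples-unique K n)
                (λ {v} _ on-L → here (constant-circuit a v (inCircuit-trans (replicate n a) (C₁.L j) v
                  (inCircuit-sym (C₁.L j) (replicate n a) L~rep) (proj₁ (∧-elim {inCircuit (C₁.L j) v} on-L))))) ,
              L~rep

        class-1-bound : onCircuits C₁.L isBalancedNegasym + δ K * (m ∸ 1) ≤ N₁ * m
        class-1-bound = begin
          sum class-1-size + δ K * (m ∸ 1)                     ≤⟨ +-monoʳ-≤ (sum class-1-size) (δ-bound (2 ∣? K)) ⟩
          sum class-1-size + ∑[ j < N₁ ] (m ∸ class-1-size j)  ≡⟨ sym (∑-distrib-+ class-1-size _) ⟩
          ∑[ j < N₁ ] (class-1-size j + (m ∸ class-1-size j))  ≡⟨ sum-cong-≗ (λ j → m+[n∸m]≡n (class-1-size≤m j)) ⟩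
          ∑[ j < N₁ ] m                                        ≡⟨ sum-const N₁ m ⟩
          N₁ * m                                               ∎
          where
          open ≤-Reasoning
          complement : Fin N₁ → ℕ
          complement j = m ∸ class-1-size j
          zero-circuit : ∃[ j ] (class-1-size j ≤ 1 × T (inCircuit (C₁.L j) (replicate n Fin.zero)))
          zero-circuit = constant-circuit-index Fin.zero negF-zero
          m∸1≤complement : ∀ {j} → class-1-size j ≤ 1 → m ∸ 1 ≤ complement j
          m∸1≤complement = ∸-monoʳ-≤ m
          δ-bound : (d : Dec (2 ∣ K)) → (if does d then 2 else 1) * (m ∸ 1) ≤ sum complement
          δ-bound (no _) = begin
            1 * (m ∸ 1)                        ≡⟨ *-identityˡ (m ∸ 1) ⟩
            m ∸ 1                              ≤⟨ m∸1≤complement (proj₁ (proj₂ zero-circuit)) ⟩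
            complement (proj₁ zero-circuit)    ≤⟨ term≤sum complement (proj₁ zero-circuit) ⟩
            sum complement                     ∎
          δ-bound (yes 2∣K) = begin
            2 * (m ∸ 1)                                                   ≡⟨ cong ((m ∸ 1) +_) (+-identityʳ (m ∸ 1)) ⟩
            (m ∸ 1) + (m ∸ 1)                                             ≤⟨ +-mono-≤ (m∸1≤complement (proj₁ (proj₂ zero-circuit)))
                                                                                        (m∸1≤complement (proj₁ (proj₂ half-circuit))) ⟩
            complement (proj₁ zero-circuit) + complement (proj₁ half-circuit) ≤⟨ two-terms≤sum complement distinct ⟩
            sum complement                                                ∎
            where
            open Half (half-of 2∣K)
            half-circuit : ∃[ j ] (class-1-size j ≤ 1 × T (inCircuit (C₁.L j) (replicate n half)))
            half-circuit = constant-circuit-index half half-fixed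
            distinct : proj₁ zero-circuit ≢ proj₁ half-circuit
            distinct same = half≢zero (constants-on-one-circuit (C₁.L (proj₁ half-circuit)) Fin.zero half
              (subst (λ j → T (inCircuit (C₁.L j) (replicate n Fin.zero))) same (proj₂ (proj₂ zero-circuit)))
              (proj₂ (proj₂ half-circuit)))

        onCircuits≤N*n : {N : ℕ} (L : Fin N → Tup) → onCircuits L isBalancedNegasym ≤ N * n
        onCircuits≤N*n {N} L = ≤-trans (sum-mono λ j → ≤-trans (countOn≤size (L j) isBalancedNegasym) (circuit-size≤n (L j)))
          (≤-reflexive (sum-const N n))

        balancedNegasym-bound : count isBalancedNegasym + δ K * (m ∸ 1) ≤ N₀ * n + N₁ * m + N₂ * n
        balancedNegasym-bound = begin
          count isBalancedNegasym + δ K * (m ∸ 1)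
            ≡⟨ cong (_+ δ K * (m ∸ 1)) (count-by-classes isBalancedNegasym (λ v → ∧-elim {isBalanced v})) ⟩
          onCircuits C₀.L isBalancedNegasym + onCircuits C₁.L isBalancedNegasym + onCircuits C₂.L isBalancedNegasym + δ K * (m ∸ 1)
            ≡⟨ +-*-Solver.solve 4 (λ a b c d → a :+ b :+ c :+ d := a :+ (b :+ d) :+ c) refl
                 (onCircuits C₀.L isBalancedNegasym) (onCircuits C₁.L isBalancedNegasym) (onCircuits C₂.L isBalancedNegasym) (δ K * (m ∸ 1)) ⟩
          onCircuits C₀.L isBalancedNegasym + (onCircuits C₁.L isBalancedNegasym + δ K * (m ∸ 1)) + onCircuits C₂.L isBalancedNegasym
            ≤⟨ +-mono-≤ (+-mono-≤ (onCircuits≤N*n C₀.L) class-1-bound) (onCircuits≤N*n C₂.L) ⟩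
          N₀ * n + N₁ * m + N₂ * n
            ∎
          where open ≤-Reasoning

  module ClassTotals {k : ℕ} where

    open NegasymmetricTuples {k}
    private
      K = suc k

    classes-total-odd : {n′ N₀ N₁ N₂ : ℕ} → CircuitCount (InN 0 {K} {suc n′}) N₀ → CircuitCount (InN 1 {K} {suc n′}) N₁ →
      CircuitCount (InN 2 {K} {suc n′}) N₂ → ¬ (2 ∣ suc n′) → N₀ + N₁ + N₂ ≡ δ K * K ^ ℕ.⌊ n′ /2⌋
    classes-total-odd {n′} {N₀} {N₁} {N₂} C₀ C₁ C₂ 2∤n with h , refl ← odd-suc⇒double n′ 2∤n =
      *-cancelʳ-≡ (N₀ + N₁ + N₂) (δ K * K ^ ℕ.⌊ h + h /2⌋) 2 (begin
      (N₀ + N₁ + N₂) * 2                                     ≡⟨ sym count-negasym+rotNegasym ⟩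
      count {K} {suc (h + h)} isNegasym + count {K} {suc (h + h)} isRotNegasym
        ≡⟨ cong₂ _+_ (trans (cong (λ n → count {K} {n} isNegasym) (sym (+-suc h h))) (count-negasym-odd h))
                     (trans (count-rotNegasym (h + h)) (cong (δ K *_) (count-negasym-even h))) ⟩
      δ K * K ^ h + δ K * K ^ h                              ≡⟨ cong (δ K * K ^ h +_) (sym (+-identityʳ _)) ⟩
      2 * (δ K * K ^ h)                                      ≡⟨ *-comm 2 (δ K * K ^ h) ⟩
      δ K * K ^ h * 2                                        ≡⟨ cong (λ e → δ K * K ^ e * 2) (n≡⌊n+n/2⌋ h) ⟩
      δ K * K ^ ℕ.⌊ h + h /2⌋ * 2                            ∎)
      where
      open ≡-Reasoning
      open Classes.AllClasses N₀ N₁ N₂ C₀ C₁ C₂ using (count-negasym+rotNegasym)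

    classes-total-even : {n′ N₀ N₁ N₂ : ℕ} → CircuitCount (InN 0 {K} {suc n′}) N₀ → CircuitCount (InN 1 {K} {suc n′}) N₁ →
      CircuitCount (InN 2 {K} {suc n′}) N₂ → 2 ∣ suc n′ →
      (N₀ + N₁ + N₂) * 2 ≡ K * K ^ ℕ.⌊ n′ ∸ 1 /2⌋ + δ K * (δ K * K ^ ℕ.⌊ n′ ∸ 1 /2⌋)
    classes-total-even {n′} {N₀} {N₁} {N₂} C₀ C₁ C₂ 2∣n with h , refl ← even-suc⇒double n′ 2∣n = begin
      (N₀ + N₁ + N₂) * 2                                     ≡⟨ sym count-negasym+rotNegasym ⟩
      count {K} {suc h + suc h} isNegasym + count {K} {suc (h + suc h)} isRotNegasym
        ≡⟨ cong₂ _+_ (count-negasym-even (suc h)) (trans (count-rotNegasym (h + suc h)) (cong (δ K *_) (count-negasym-odd h))) ⟩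
      K * K ^ h + δ K * (δ K * K ^ h)                        ≡⟨ cong (λ e → K * K ^ e + δ K * (δ K * K ^ e)) half ⟩
      K * K ^ ℕ.⌊ h + suc h ∸ 1 /2⌋ + δ K * (δ K * K ^ ℕ.⌊ h + suc h ∸ 1 /2⌋) ∎
      where
      open ≡-Reasoning
      open Classes.AllClasses N₀ N₁ N₂ C₀ C₁ C₂ using (count-negasym+rotNegasym)
      half : h ≡ ℕ.⌊ h + suc h ∸ 1 /2⌋
      half = trans (n≡⌊n+n/2⌋ h) (cong (λ x → ℕ.⌊ x ∸ 1 /2⌋) (sym (+-suc h h)))

    class-1-total : {n′ N₀ N₁ N₂ : ℕ} → CircuitCount (InN 0 {K} {suc n′}) N₀ → CircuitCount (InN 1 {K} {suc n′}) N₁ →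
      CircuitCount (InN 2 {K} {suc n′}) N₂ → (t m : ℕ) → suc n′ ≡ 2 ^ t * m → ¬ (2 ∣ m) → N₁ ≡ δ K * K ^ ℕ.⌊ m ∸ 1 /2⌋
    class-1-total {n′} {N₀} {N₁} {N₂} C₀ C₁ C₂ t m n≡2^t*m m-odd with g , refl ← ∤2⇒odd m m-odd = begin
      N₁                                           ≡⟨ sym count-negasymFixedBy≡N₁ ⟩
      count {K} {suc n′} (isNegasymFixedBy m)      ≡⟨ cong (λ n → count {K} {n} (isNegasymFixedBy m)) n≡2^t*m ⟩
      count {K} {2 ^ t * m} (isNegasymFixedBy m)   ≡⟨ count-negasymFixedBy-odd-part t m ⟩
      count {K} {suc (g + g)} isNegasym            ≡⟨ cong (λ n → count {K} {n} isNegasym) (sym (+-suc g g)) ⟩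
      count {K} {g + suc g} isNegasym              ≡⟨ count-negasym-odd g ⟩
      δ K * K ^ g                                  ≡⟨ cong (λ e → δ K * K ^ e) (n≡⌊n+n/2⌋ g) ⟩
      δ K * K ^ ℕ.⌊ g + g /2⌋                      ∎
      where
      open ≡-Reasoning
      open Classes.AllClasses.OddPart N₀ N₁ N₂ C₀ C₁ C₂ t m n≡2^t*m m-odd using (count-negasymFixedBy≡N₁)

  module ClosedForms where

    open import Data.Integer as ℤ using (ℤ; +_; _-_) renaming (_+_ to _+ℤ_; _*_ to _*ℤ_; _≤_ to _≤ℤ_)
    import Data.Integer.Properties as ℤₚ
    open import Data.Integer.Solver using () renaming (module +-*-Solver to ℤ-Solver)
    open ℤ-Solver using (solve; con) renaming (_:+_ to _⊕_; _:*_ to _⊗_; _:-_ to _⊝_; _:=_ to _⊜_)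

    +-sum3 : (a b c : ℕ) → + (a + b + c) ≡ + a +ℤ + b +ℤ + c
    +-sum3 a b c = trans (ℤₚ.pos-+ (a + b) c) (cong (_+ℤ + c) (ℤₚ.pos-+ a b))

    ≤⇒difference≤ : (a b c : ℕ) → a ≤ c + c + b → + a - + b ≤ℤ + 2 *ℤ + c
    ≤⇒difference≤ a b c a≤2c+b = ℤₚ.≤-trans (ℤₚ.+-monoˡ-≤ (ℤ.- + b) (ℤ.+≤+ a≤2c+b)) (ℤₚ.≤-reflexive (begin
      + (c + c + b) - + b         ≡⟨ cong (_- + b) (+-sum3 c c b) ⟩
      + c +ℤ + c +ℤ + b - + b     ≡⟨ solve 2 (λ x y → x ⊕ x ⊕ y ⊝ y ⊜ con (+ 2) ⊗ x) refl (+ c) (+ b) ⟩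
      + 2 *ℤ + c                  ∎))
      where open ≡-Reasoning

    s₂-as-difference : (A n m-1 N₀ N₁ N₂ d : ℕ) →
      + A - + n *ℤ (+ N₀ +ℤ + N₂) - + suc m-1 *ℤ (+ N₁ - + d) - + d ≡ + (A + d * m-1) - + (N₀ * n + N₁ * suc m-1 + N₂ * n)
    s₂-as-difference A n m-1 N₀ N₁ N₂ d = begin
      + A - + n *ℤ (+ N₀ +ℤ + N₂) - + suc m-1 *ℤ (+ N₁ - + d) - + d
        ≡⟨ solve 7 (λ A n m N₀ N₁ N₂ d → A ⊝ n ⊗ (N₀ ⊕ N₂) ⊝ (con (+ 1) ⊕ m) ⊗ (N₁ ⊝ d) ⊝ d
                                        ⊜ (A ⊕ d ⊗ m) ⊝ (N₀ ⊗ n ⊕ N₁ ⊗ (con (+ 1) ⊕ m) ⊕ N₂ ⊗ n))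
             refl (+ A) (+ n) (+ m-1) (+ N₀) (+ N₁) (+ N₂) (+ d) ⟩
      (+ A +ℤ + d *ℤ + m-1) - (+ N₀ *ℤ + n +ℤ + N₁ *ℤ + suc m-1 +ℤ + N₂ *ℤ + n)
        ≡⟨ sym (cong₂ _-_ (trans (ℤₚ.pos-+ A (d * m-1)) (cong (+ A +ℤ_) (ℤₚ.pos-* d m-1)))
                          (trans (+-sum3 (N₀ * n) (N₁ * suc m-1) (N₂ * n))
                                 (cong₂ _+ℤ_ (cong₂ _+ℤ_ (ℤₚ.pos-* N₀ n) (ℤₚ.pos-* N₁ (suc m-1))) (ℤₚ.pos-* N₂ n)))) ⟩
      + (A + d * m-1) - + (N₀ * n + N₁ * suc m-1 + N₂ * n)
        ∎
      where open ≡-Reasoning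

    s₂-odd : (A n N₀ N₁ N₂ d Q : ℕ) → N₀ + N₁ + N₂ ≡ d * Q →
      + A - + n *ℤ (+ N₀ +ℤ + N₂) - + n *ℤ (+ N₁ - + d) - + d ≡ + A - + d *ℤ (+ n *ℤ (+ Q - + 1) +ℤ + 1)
    s₂-odd A n N₀ N₁ N₂ d Q total = begin
      + A - + n *ℤ (+ N₀ +ℤ + N₂) - + n *ℤ (+ N₁ - + d) - + d
        ≡⟨ solve 6 (λ A n N₀ N₁ N₂ d → A ⊝ n ⊗ (N₀ ⊕ N₂) ⊝ n ⊗ (N₁ ⊝ d) ⊝ d ⊜ A ⊝ n ⊗ (N₀ ⊕ N₁ ⊕ N₂) ⊕ n ⊗ d ⊝ d)
             refl (+ A) (+ n) (+ N₀) (+ N₁) (+ N₂) (+ d) ⟩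
      + A - + n *ℤ (+ N₀ +ℤ + N₁ +ℤ + N₂) +ℤ + n *ℤ + d - + d
        ≡⟨ cong (λ S → + A - + n *ℤ S +ℤ + n *ℤ + d - + d) (trans (sym (+-sum3 N₀ N₁ N₂)) (trans (cong +_ total) (ℤₚ.pos-* d Q))) ⟩
      + A - + n *ℤ (+ d *ℤ + Q) +ℤ + n *ℤ + d - + d
        ≡⟨ solve 4 (λ A n d Q → A ⊝ n ⊗ (d ⊗ Q) ⊕ n ⊗ d ⊝ d ⊜ A ⊝ d ⊗ (n ⊗ (Q ⊝ con (+ 1)) ⊕ con (+ 1)))
             refl (+ A) (+ n) (+ d) (+ Q) ⟩
      + A - + d *ℤ (+ n *ℤ (+ Q - + 1) +ℤ + 1)
        ∎
      where open ≡-Reasoning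

    s₂-even : (A K n m N₀ N₁ N₂ d P G : ℕ) → (N₀ + N₁ + N₂) * 2 ≡ K * P + d * (d * P) → N₁ ≡ d * G →
      + 2 *ℤ (+ A - + n *ℤ (+ N₀ +ℤ + N₂) - + m *ℤ (+ N₁ - + d) - + d) ≡
        + 2 *ℤ + A - + n *ℤ + P *ℤ (+ d *ℤ + d +ℤ + K) +ℤ + 2 *ℤ + n *ℤ + d *ℤ + G
          - + 2 *ℤ + m *ℤ + d *ℤ (+ G - + 1) - + 2 *ℤ + d
    s₂-even A K n m N₀ N₁ N₂ d P G total N₁≡ = begin
      + 2 *ℤ (+ A - + n *ℤ (+ N₀ +ℤ + N₂) - + m *ℤ (+ N₁ - + d) - + d)
        ≡⟨ solve 7 (λ A n m N₀ N₁ N₂ d →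
                      con (+ 2) ⊗ (A ⊝ n ⊗ (N₀ ⊕ N₂) ⊝ m ⊗ (N₁ ⊝ d) ⊝ d)
                      ⊜ con (+ 2) ⊗ A ⊝ n ⊗ ((N₀ ⊕ N₁ ⊕ N₂) ⊗ con (+ 2)) ⊕ con (+ 2) ⊗ n ⊗ N₁
                         ⊝ con (+ 2) ⊗ m ⊗ (N₁ ⊝ d) ⊝ con (+ 2) ⊗ d)
             refl (+ A) (+ n) (+ m) (+ N₀) (+ N₁) (+ N₂) (+ d) ⟩
      + 2 *ℤ + A - + n *ℤ ((+ N₀ +ℤ + N₁ +ℤ + N₂) *ℤ + 2) +ℤ + 2 *ℤ + n *ℤ + N₁ - + 2 *ℤ + m *ℤ (+ N₁ - + d) - + 2 *ℤ + d
        ≡⟨ cong₂ (λ S N → + 2 *ℤ + A - + n *ℤ S +ℤ + 2 *ℤ + n *ℤ N - + 2 *ℤ + m *ℤ (N - + d) - + 2 *ℤ + d) total-ℤ N₁-ℤ ⟩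
      + 2 *ℤ + A - + n *ℤ (+ K *ℤ + P +ℤ + d *ℤ (+ d *ℤ + P)) +ℤ + 2 *ℤ + n *ℤ (+ d *ℤ + G) - + 2 *ℤ + m *ℤ (+ d *ℤ + G - + d) - + 2 *ℤ + d
        ≡⟨ solve 7 (λ A K n m d P G →
                      con (+ 2) ⊗ A ⊝ n ⊗ (K ⊗ P ⊕ d ⊗ (d ⊗ P)) ⊕ con (+ 2) ⊗ n ⊗ (d ⊗ G) ⊝ con (+ 2) ⊗ m ⊗ (d ⊗ G ⊝ d) ⊝ con (+ 2) ⊗ d
                      ⊜ con (+ 2) ⊗ A ⊝ n ⊗ P ⊗ (d ⊗ d ⊕ K) ⊕ con (+ 2) ⊗ n ⊗ d ⊗ G ⊝ con (+ 2) ⊗ m ⊗ d ⊗ (G ⊝ con (+ 1)) ⊝ con (+ 2) ⊗ d)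
             refl (+ A) (+ K) (+ n) (+ m) (+ d) (+ P) (+ G) ⟩
      + 2 *ℤ + A - + n *ℤ + P *ℤ (+ d *ℤ + d +ℤ + K) +ℤ + 2 *ℤ + n *ℤ + d *ℤ + G - + 2 *ℤ + m *ℤ + d *ℤ (+ G - + 1) - + 2 *ℤ + d
        ∎
      where
      open ≡-Reasoning
      total-ℤ : (+ N₀ +ℤ + N₁ +ℤ + N₂) *ℤ + 2 ≡ + K *ℤ + P +ℤ + d *ℤ (+ d *ℤ + P)
      total-ℤ = begin
        (+ N₀ +ℤ + N₁ +ℤ + N₂) *ℤ + 2   ≡⟨ cong (_*ℤ + 2) (sym (+-sum3 N₀ N₁ N₂)) ⟩
        + (N₀ + N₁ + N₂) *ℤ + 2         ≡⟨ sym (ℤₚ.pos-* (N₀ + N₁ + N₂) 2) ⟩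
        + ((N₀ + N₁ + N₂) * 2)          ≡⟨ cong +_ total ⟩
        + (K * P + d * (d * P))         ≡⟨ ℤₚ.pos-+ (K * P) _ ⟩
        + (K * P) +ℤ + (d * (d * P))    ≡⟨ cong₂ _+ℤ_ (ℤₚ.pos-* K P) (trans (ℤₚ.pos-* d (d * P)) (cong (+ d *ℤ_) (ℤₚ.pos-* d P))) ⟩
        + K *ℤ + P +ℤ + d *ℤ (+ d *ℤ + P) ∎
      N₁-ℤ : + N₁ ≡ + d *ℤ + G
      N₁-ℤ = trans (cong +_ N₁≡) (ℤₚ.pos-* d G)

open import Defs
open import Data.Nat using (ℕ; _≥_; _^_; ⌊_/2⌋; _∸_)
open import Data.Nat.Divisibility using (_∣_)
open import Data.Integer using (ℤ; +_; _-_; _⊔_; _≤_) renaming (_+_ to _+ℤ_; _*_ to _*ℤ_)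
open import Data.Bool using (Bool)
open import Data.Product using (_×_)
open import Relation.Nullary using (¬_)
open import Relation.Binary.PropositionalEquality using (_≡_)
open import Data.Nat as ℕ using (zero; suc; _+_; _*_)
open import Data.Nat.Properties using (≤-trans; ≤-reflexive; +-assoc; +-monoˡ-≤; +-monoʳ-≤)
open import Data.Nat.Divisibility using (divides)
open import Data.Integer.Properties using (⊔-lub)
open import Data.Empty using (⊥-elim)
open import Data.Product using (_,_)
open import Relation.Binary.PropositionalEquality using (refl; subst; sym; trans; cong)

open Lemmas

theorem4p13 : (k n t m : ℕ) → k ≥ 3 → n ≥ 3 → n ≡ 2 ^ t Data.Nat.* m → ¬ (2 ∣ m) →
  (N₀ N₁ N₂ : ℕ) →
  CircuitCount (InN 0 {k} {n}) N₀ → CircuitCount (InN 1 {k} {n}) N₁ → CircuitCount (InN 2 {k} {n}) N₂ →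
  (X : Tuple k n → Bool) → IsX X →
  let d = + δ k
      s2 = + (k ^ n) - (+ n *ℤ (+ N₀ +ℤ + N₂)) - (+ m *ℤ (+ N₁ - d)) - d
  in ((+ (k ^ n) - + rMid k n) ⊔ s2 ≤ + 2 *ℤ + count X)
     × (¬ (2 ∣ n) → s2 ≡ + (k ^ n) - d *ℤ (+ n *ℤ (+ (k ^ ⌊ (n ∸ 1) /2⌋) - + 1) +ℤ + 1))
     × (2 ∣ n → + 2 *ℤ s2 ≡
          + 2 *ℤ + (k ^ n) - + n *ℤ + (k ^ ⌊ (n ∸ 2) /2⌋) *ℤ (d *ℤ d +ℤ + k)
          +ℤ + 2 *ℤ + n *ℤ d *ℤ + (k ^ ⌊ (m ∸ 1) /2⌋)
          - + 2 *ℤ + m *ℤ d *ℤ (+ (k ^ ⌊ (m ∸ 1) /2⌋) - + 1)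
          - + 2 *ℤ d)
theorem4p13 (suc k) (suc n′) t zero _ _ _ m-odd = ⊥-elim (m-odd (divides 0 refl))
theorem4p13 (suc k) (suc n′) t (suc m-1) _ _ n≡2^t*m m-odd N₀ N₁ N₂ C₀ C₁ C₂ X X-admissible =
  ⊔-lub (≤⇒difference≤ (K ^ n) (rMid K n) (count X) first-bound)
        (subst (_≤ + 2 *ℤ + count X) (sym (s₂-as-difference (K ^ n) n m-1 N₀ N₁ N₂ (δ K)))
               (≤⇒difference≤ _ _ (count X) second-bound)) ,
  (λ 2∤n → trans (cong s₂-with (odd-part-of-odd {t = t} n≡2^t*m 2∤n))
                 (s₂-odd (K ^ n) n N₀ N₁ N₂ (δ K) _ (classes-total-odd C₀ C₁ C₂ 2∤n))) ,
  (λ 2∣n → s₂-even (K ^ n) K n (suc m-1) N₀ N₁ N₂ (δ K) _ _ (classes-total-even C₀ C₁ C₂ 2∣n)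
                   (class-1-total C₀ C₁ C₂ t (suc m-1) n≡2^t*m m-odd))
  where
  K n : ℕ
  K = suc k
  n = suc n′
  open Pseudoweight {k} {n′}
  open Admissible X X-admissible using (k^n≤2X+balancedNegasym)
  open Classes.AllClasses.OddPart N₀ N₁ N₂ C₀ C₁ C₂ t (suc m-1) n≡2^t*m m-odd using (balancedNegasym-bound)
  open ClassTotals {k}
  open ClosedForms
  first-bound : K ^ n ℕ.≤ count X + count X + rMid K n
  first-bound = ≤-trans k^n≤2X+balancedNegasym (+-monoʳ-≤ (count X + count X) count-balancedNegasym≤count-balanced)
  second-bound : K ^ n + δ K * m-1 ℕ.≤ count X + count X + (N₀ * n + N₁ * suc m-1 + N₂ * n)
  second-bound = ≤-trans (+-monoˡ-≤ (δ K * m-1) k^n≤2X+balancedNegasym)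
    (≤-trans (≤-reflexive (+-assoc (count X + count X) _ _)) (+-monoʳ-≤ (count X + count X) balancedNegasym-bound))
  s₂-with : ℕ → ℤ
  s₂-with m = + (K ^ n) - + n *ℤ (+ N₀ +ℤ + N₂) - + m *ℤ (+ N₁ - + δ K) - + δ K
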